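{- Let $P$ be a finite poset with a minimum element $\hat{0}$ and trunk $T$ with $\#T=t$, let $m$ be a positive integer with $\mathcal{L}_m(P)\neq\emptyset$, and set $P'=P-T$. Suppose $P'$ (which has a minimum element) has a branch with $k$ elements, where $1\le k\le m-t-2$. Consider the action of $\partial_K$ on $\mathcal{L}_m(P)$. 1. The order of $\partial_K$ on $\mathcal{L}_m(P)$ is divisible by $m-t-1$. 2. If $\gcd(k,m-t-1)=1$, then $m-t-1$ divides the size of every orbit of $\partial_K$ on $\mathcal{L}_m(P)$.
   Context: For a positive integer $m$, $[m]=\{1,\dots,m\}$. An $m$-packed labeling of a finite poset $P$ is a surjection $L:P\to[m]$ such that $x<_P y$ implies $L(x)<L(y)$; $\mathcal{L}_m(P)$ is the set of them. $K$-promotion $\partial_K:\mathcal{L}_m(P)\to\mathcal{L}_m(P)$: given $L$, erase the labels of all elements labeled $1$; then for $i=2,\dots,m$ in turn, for every cover relation $x\lessdot y$ with $x$ currently unlabeled and $y$ currently labeled $i$, give $x$ label $i$ and erase the label of $y$ (simultaneously for all such pairs); finally decrease every existing label by $1$ and label every unlabeled element $m$. This is a bijection of $\mathcal{L}_m(P)$. The trunk of a poset with minimum $\hat0$ is the longest chain $\hat{0}=x_1\lessdot\cdots\lessdot x_t$ such that each $x_i$ is covered by exactly one element of $P$. For a poset $Q$ with minimum $\hat0_Q$, the principal subposets are the connected components (in the Hasse diagram) of $Q-\{\hat0_Q\}$, and a branch is a principal subposet which is a chain. -}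

module Defs where

open import Data.Nat using (ℕ; zero; suc; _+_; _∸_; _≤_; _<_; _≡ᵇ_)
open import Data.Fin using (Fin)
open import Data.Fin.Subset using (Subset; _∈_; _∉_)
open import Data.Bool using (Bool; true; false; _∧_; not; if_then_else_)
open import Data.Maybe using (Maybe; just; nothing; is-nothing)
open import Data.List using (List; foldl; map; upTo; allFin)
open import Data.Bool.ListAction using (any)
open import Data.Unit using (⊤)
open import Data.Product using (Σ; ∃; _×_; _,_)
open import Data.Sum using (_⊎_)
open import Relation.Nullary using (¬_; ⌊_⌋)
open import Relation.Binary.PropositionalEquality using (_≡_; _≢_)
open import Relation.Binary.Definitions using (Decidable)
open import Relation.Binary.Structures using (IsPartialOrder)
open import Relation.Binary.Construct.Closure.ReflexiveTransitive using (Star)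
open import Function using (_∘_)
import Data.Fin as F

record FinPoset (n : ℕ) : Set₁ where
  field
    _≼_            : Fin n → Fin n → Set
    isPartialOrder : IsPartialOrder _≡_ _≼_
    _≼?_           : Decidable _≼_

iter : {A : Set} → ℕ → (A → A) → A → A
iter zero    f a = a
iter (suc d) f a = f (iter d f a)

module _ {n : ℕ} (P : FinPoset n) where
  open FinPoset P

  _≺_ : Fin n → Fin n → Set
  x ≺ y = x ≼ y × x ≢ y

  _⋖_ : Fin n → Fin n → Set
  x ⋖ y = x ≺ y × (∀ z → ¬ (x ≺ z × z ≺ y))

  IsMinimum : Fin n → Set
  IsMinimum z = ∀ x → z ≼ x

  CoveredByExactlyOne : Fin n → Set
  CoveredByExactlyOne x = ∃ λ y → x ⋖ y × (∀ y' → x ⋖ y' → y' ≡ y)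

  IsPackedLabeling : ℕ → (Fin n → ℕ) → Set
  IsPackedLabeling m L =
      (∀ x → 1 ≤ L x × L x ≤ m)
    × (∀ i → 1 ≤ i → i ≤ m → ∃ λ x → L x ≡ i)
    × (∀ x y → x ≺ y → L x < L y)

  IsTrunkChain : Fin n → (t : ℕ) → (Fin t → Fin n) → Set
  IsTrunkChain z zero    c = ⊤
  IsTrunkChain z (suc t) c =
      (c F.zero ≡ z)
    × (∀ (i : Fin t) → c (F.inject₁ i) ⋖ c (F.suc i))
    × (∀ (i : Fin (suc t)) → CoveredByExactlyOne (c i))

  IsTrunk : Fin n → (t : ℕ) → (Fin t → Fin n) → Set
  IsTrunk z t c = IsTrunkChain z t c
                × (∀ t' c' → IsTrunkChain z t' c' → t' ≤ t)

  InTrunk : {t : ℕ} → (Fin t → Fin n) → Fin n → Set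
  InTrunk c x = ∃ λ i → c i ≡ x

  IsMinimumOfComplement : {t : ℕ} → (Fin t → Fin n) → Fin n → Set
  IsMinimumOfComplement c z' = ¬ InTrunk c z' × (∀ x → ¬ InTrunk c x → z' ≼ x)

  InQ : {t : ℕ} → (Fin t → Fin n) → Fin n → Fin n → Set
  InQ c z' x = ¬ InTrunk c x × x ≢ z'

  CoverIn : (Fin n → Set) → Fin n → Fin n → Set
  CoverIn S x y = S x × S y × x ≺ y × (∀ z → S z → ¬ (x ≺ z × z ≺ y))

  HasseAdj : (Fin n → Set) → Fin n → Fin n → Set
  HasseAdj S x y = CoverIn S x y ⊎ CoverIn S y x

  IsComponent : (Fin n → Set) → Subset n → Set
  IsComponent S B = ∃ λ x → S x × (∀ y → (y ∈ B → S y × Star (HasseAdj S) x y)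
                                       × (S y → Star (HasseAdj S) x y → y ∈ B))

  -- B is a branch of P' (a principal subposet of P' that is a chain)
  IsBranch : {t : ℕ} → (Fin t → Fin n) → Fin n → Subset n → Set
  IsBranch c z' B = IsComponent (InQ c z') B
                  × (∀ x y → x ∈ B → y ∈ B → x ≼ y ⊎ y ≼ x)

  -- K-promotion (unlabeled elements are represented by nothing)

  _<ᵇ_ : Fin n → Fin n → Bool
  x <ᵇ y = ⌊ x ≼? y ⌋ ∧ not ⌊ x F.≟ y ⌋

  anyFin : (Fin n → Bool) → Bool
  anyFin p = any p (allFin n)

  _⋖ᵇ_ : Fin n → Fin n → Bool
  x ⋖ᵇ y = (x <ᵇ y) ∧ not (anyFin (λ z → (x <ᵇ z) ∧ (z <ᵇ y)))

  labeledWith : ℕ → Maybe ℕ → Bool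
  labeledWith i nothing  = false
  labeledWith i (just j) = j ≡ᵇ i

  kStep : ℕ → (Fin n → Maybe ℕ) → (Fin n → Maybe ℕ)
  kStep i s z with s z
  ... | nothing = if anyFin (λ y → (z ⋖ᵇ y) ∧ labeledWith i (s y)) then just i else nothing
  ... | just j  = if (j ≡ᵇ i) ∧ anyFin (λ x → (x ⋖ᵇ z) ∧ is-nothing (s x))
                  then nothing else just j

  kPromotion : ℕ → (Fin n → ℕ) → (Fin n → ℕ)
  kPromotion m L z with final z
    where
      initial : Fin n → Maybe ℕ
      initial x = if L x ≡ᵇ 1 then nothing else just (L x)
      final : Fin n → Maybe ℕ
      final = foldl (λ s i → kStep i s) initial (map (2 +_) (upTo (m ∸ 1)))
  ... | nothing = m
  ... | just j  = j ∸ 1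

  IsOrderOfPromotion : ℕ → ℕ → Set
  IsOrderOfPromotion m d =
      1 ≤ d
    × (∀ L → IsPackedLabeling m L → ∀ x → iter d (kPromotion m) L x ≡ L x)
    × (∀ d' → 1 ≤ d' → d' < d →
         ¬ (∀ L → IsPackedLabeling m L → ∀ x → iter d' (kPromotion m) L x ≡ L x))

  IsOrbitSize : ℕ → (Fin n → ℕ) → ℕ → Set
  IsOrbitSize m L d =
      1 ≤ d
    × (∀ x → iter d (kPromotion m) L x ≡ L x)
    × (∀ d' → 1 ≤ d' → d' < d → ¬ (∀ x → iter d' (kPromotion m) L x ≡ L x))

module Submission where

-- Every packed labelling puts 1, …, t on the trunk and t+1 on z′, so the branch, a chain of k elements, carries k of
-- the labels 2+t, …, m, a window of size q = m − t − 1. Tracing K-promotion shows that the set of branch offsets in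
-- this window rotates down by one modulo q at each step: either the bottom of the branch carries 2+t, moves it to z′,
-- and the hole slides up the chain, whose top then receives m; or every branch label simply drops by one.
-- For the order, squeeze the branch onto the labels 2+t, …, 1+t+k: its offset set {0, …, k−1} is preserved by a
-- rotation by d only if q ∣ d, since 1 ≤ k < q. For an orbit of length d, the sum of the offsets drops by k at each
-- step but gains q at each wrap-around, so q ∣ d·k, and gcd(k, q) = 1 gives q ∣ d.

open import Defs
open import Data.Nat using (ℕ; _+_; _∸_; _≤_)
open import Data.Nat.Divisibility using (_∣_)
open import Data.Nat.GCD using (gcd)
open import Data.Fin using (Fin)
open import Data.Fin.Subset using (Subset; ∣_∣)
open import Data.Product using (∃; _×_)
open import Relation.Binary.PropositionalEquality using (_≡_)

open import Data.Nat as ℕ using (zero; suc; _*_; _<_; _≡ᵇ_; z≤n; s≤s; NonZero)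
import Data.Nat.Properties as NP
open import Data.Nat.DivMod using (_%_; m<n⇒m%n≡m; n%n≡0; %-distribˡ-+; m%n<n; m%n%n≡m%n; m≤n⇒[n∸m]%m≡n%m)
open import Data.Nat.Divisibility using (divides; m%n≡0⇒n∣m)
open import Data.Nat.GCD using (gcd-comm)
open import Data.Nat.Coprimality using (Coprime; gcd≡1⇒coprime; coprime-divisor)
open import Data.Nat.Solver using (module +-*-Solver)
open import Data.Fin as F using ()
import Data.Fin.Properties as FP
open import Data.Fin.Subset using (_∈_; _∉_; inside; outside)
open import Data.Fin.Subset.Properties using (_∈?_)
open import Data.Vec.Base using ([]; _∷_; here; there)
open import Data.Bool using (true; false; T; _∧_; not; if_then_else_)
open import Data.Bool.Properties using (T-∧; T-≡)
open import Data.Maybe using (Maybe; just; nothing; is-nothing)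
open import Data.Maybe.Properties using (just-injective)
import Data.Maybe.Properties as MP
open import Data.List using ([]; _∷_; _∷ʳ_; foldl; map; upTo; allFin)
import Data.List.Properties as LP
open import Data.List.Membership.Propositional using (lose)
open import Data.List.Membership.Propositional.Properties using (∈-allFin)
open import Data.List.Relation.Unary.Any using (satisfied)
open import Data.List.Relation.Unary.Any.Properties using (any⁺; any⁻)
open import Data.Product using (Σ; _,_; proj₁; proj₂)
import Data.Sum
open Data.Sum using (_⊎_; inj₁; inj₂; [_,_]′)
open import Data.Empty using (⊥)
open import Data.Unit using (tt)
open import Function using (_∘_; _∘′_; id; _⇔_; mk⇔; Equivalence)
open import Relation.Nullary using (¬_; ¬?; Dec; yes; no; contradiction; _×-dec_)
open import Relation.Nullary.Decidable using (toWitness; fromWitness; toWitnessFalse; fromWitnessFalse)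
open import Relation.Binary.Definitions using (tri<; tri≈; tri>)
open import Relation.Binary.Structures using (IsPartialOrder)
open import Relation.Binary.PropositionalEquality using (_≢_; refl; sym; trans; cong; cong₂; subst; subst₂; module ≡-Reasoning)
open import Relation.Binary.Construct.Closure.ReflexiveTransitive using (Star; ε; _◅_; _◅◅_)
open import Algebra.Properties.CommutativeMonoid.Sum NP.+-0-commutativeMonoid using (sum-syntax; ∑-distrib-+; sum-cong-≗)
open import Algebra.Properties.CommutativeSemigroup NP.+-commutativeSemigroup using () renaming (interchange to +-interchange)
open +-*-Solver using (solve; _:+_; _:*_; _:=_; con)
open Equivalence using (to; from)

indicator : {A : Set} → Dec A → ℕ
indicator (yes _) = 1
indicator (no _)  = 0

indicator-yes : {A : Set} → A → (d : Dec A) → indicator d ≡ 1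
indicator-yes a (yes _) = refl
indicator-yes a (no ¬a) = contradiction a ¬a

indicator-no : {A : Set} → ¬ A → (d : Dec A) → indicator d ≡ 0
indicator-no ¬a (yes a) = contradiction a ¬a
indicator-no ¬a (no _)  = refl

indicator-cong : {A B : Set} → A ⇔ B → (a : Dec A) (b : Dec B) → indicator a ≡ indicator b
indicator-cong A⇔B (yes a) b = sym (indicator-yes (to A⇔B a) b)
indicator-cong A⇔B (no ¬a) b = sym (indicator-no (¬a ∘ from A⇔B) b)

indicator≡1 : {A : Set} (d : Dec A) → indicator d ≡ 1 → A
indicator≡1 (yes a) _ = a

sumBelow : ℕ → (ℕ → ℕ) → ℕ
sumBelow zero    h = 0
sumBelow (suc r) h = sumBelow r h + h r

sumBelow-cong : ∀ r {h h′ : ℕ → ℕ} → (∀ o → o < r → h o ≡ h′ o) → sumBelow r h ≡ sumBelow r h′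
sumBelow-cong zero    eq = refl
sumBelow-cong (suc r) eq = cong₂ _+_ (sumBelow-cong r (λ o o<r → eq o (NP.m<n⇒m<1+n o<r))) (eq r NP.≤-refl)

sumBelow-zero : ∀ r (h : ℕ → ℕ) → (∀ o → o < r → h o ≡ 0) → sumBelow r h ≡ 0
sumBelow-zero zero    h eq = refl
sumBelow-zero (suc r) h eq = cong₂ _+_ (sumBelow-zero r h (λ o o<r → eq o (NP.m<n⇒m<1+n o<r))) (eq r NP.≤-refl)

sumBelow-distrib-+ : ∀ r (h h′ : ℕ → ℕ) → sumBelow r (λ o → h o + h′ o) ≡ sumBelow r h + sumBelow r h′
sumBelow-distrib-+ zero    h h′ = refl
sumBelow-distrib-+ (suc r) h h′ = begin
  sumBelow r (λ o → h o + h′ o) + (h r + h′ r)      ≡⟨ cong (_+ (h r + h′ r)) (sumBelow-distrib-+ r h h′) ⟩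
  (sumBelow r h + sumBelow r h′) + (h r + h′ r)     ≡⟨ +-interchange (sumBelow r h) (sumBelow r h′) (h r) (h′ r) ⟩
  (sumBelow r h + h r) + (sumBelow r h′ + h′ r)     ∎
  where open ≡-Reasoning

sumBelow-suc : ∀ r (h : ℕ → ℕ) → sumBelow (suc r) h ≡ h 0 + sumBelow r (h ∘ suc)
sumBelow-suc zero    h = NP.+-comm 0 (h 0)
sumBelow-suc (suc r) h = begin
  sumBelow (suc r) h + h (suc r)            ≡⟨ cong (_+ h (suc r)) (sumBelow-suc r h) ⟩
  (h 0 + sumBelow r (h ∘ suc)) + h (suc r)  ≡⟨ NP.+-assoc (h 0) _ _ ⟩
  h 0 + sumBelow (suc r) (h ∘ suc)          ∎
  where open ≡-Reasoning

sumBelow-+ : ∀ a r (h : ℕ → ℕ) → sumBelow (a + r) h ≡ sumBelow a h + sumBelow r (λ o → h (a + o))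
sumBelow-+ a zero    h = trans (cong (λ w → sumBelow w h) (NP.+-identityʳ a)) (sym (NP.+-identityʳ _))
sumBelow-+ a (suc r) h = begin
  sumBelow (a + suc r) h                                      ≡⟨ cong (λ w → sumBelow w h) (NP.+-suc a r) ⟩
  sumBelow (a + r) h + h (a + r)                              ≡⟨ cong (_+ h (a + r)) (sumBelow-+ a r h) ⟩
  (sumBelow a h + sumBelow r (λ o → h (a + o))) + h (a + r)   ≡⟨ NP.+-assoc (sumBelow a h) _ _ ⟩
  sumBelow a h + sumBelow (suc r) (λ o → h (a + o))           ∎
  where open ≡-Reasoning

moment : ℕ → (ℕ → ℕ) → ℕ
moment r f = sumBelow r (λ o → o * f o)

moment-rotate : ∀ q′ (f g : ℕ → ℕ) → (∀ o → o < suc q′ → g o ≡ f (suc o % suc q′)) →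
  moment (suc q′) g + sumBelow (suc q′) f ≡ moment (suc q′) f + suc q′ * f 0
moment-rotate q′ f g g≡rotated-f = begin
  moment (suc q′) g + sumBelow (suc q′) f        ≡⟨ cong₂ _+_ moment-g (sumBelow-suc q′ f) ⟩
  (A + q′ * f 0) + (f 0 + S)                     ≡⟨ solve 4 (λ A q′ F S → (A :+ q′ :* F) :+ (F :+ S) := (S :+ A) :+ (con 1 :+ q′) :* F) refl A q′ (f 0) S ⟩
  (S + A) + suc q′ * f 0                         ≡⟨ cong (_+ suc q′ * f 0) moment-f ⟨
  moment (suc q′) f + suc q′ * f 0               ∎
  where
    open ≡-Reasoning
    A = moment q′ (f ∘ suc)
    S = sumBelow q′ (f ∘ suc)
    g-shift : ∀ o → o < q′ → g o ≡ f (suc o)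
    g-shift o o<q′ = trans (g≡rotated-f o (NP.m<n⇒m<1+n o<q′)) (cong f (m<n⇒m%n≡m (s≤s o<q′)))
    g-last : g q′ ≡ f 0
    g-last = trans (g≡rotated-f q′ NP.≤-refl) (cong f (n%n≡0 (suc q′)))
    moment-g : moment (suc q′) g ≡ A + q′ * f 0
    moment-g = cong₂ _+_ (sumBelow-cong q′ (λ o o<q′ → cong (o *_) (g-shift o o<q′))) (cong (q′ *_) g-last)
    moment-f : moment (suc q′) f ≡ S + A
    moment-f = trans (sumBelow-suc q′ (λ o → o * f o)) (sumBelow-distrib-+ q′ (f ∘ suc) (λ o → o * f (suc o)))

module Count {D : ℕ → Set} (D? : ∀ w → Dec (D w)) where

  count : ℕ → ℕ
  count r = sumBelow r (λ w → indicator (D? w))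

  count-suc-yes : ∀ r → D r → count (suc r) ≡ suc (count r)
  count-suc-yes r dr = trans (cong (count r +_) (indicator-yes dr (D? r))) (NP.+-comm (count r) 1)

  count-mono : ∀ {a b} → a ≤ b → count a ≤ count b
  count-mono {a} {b} a≤b = subst (λ b → count a ≤ count b) (NP.m∸n+n≡m a≤b) (grow (b ∸ a))
    where
      grow : ∀ d → count a ≤ count (d + a)
      grow zero    = NP.≤-refl
      grow (suc d) = NP.≤-trans (grow d) (NP.m≤m+n (count (d + a)) _)

  count-increases : ∀ {a b} → D a → a < b → count a < count b
  count-increases {a} da a<b = NP.≤-trans (NP.≤-reflexive (sym (count-suc-yes a da))) (count-mono a<b)

  count-hit : ∀ r j → j < count r → ∃ λ w → w < r × D w × count w ≡ j
  count-hit (suc r) j j<count with j NP.<? count r | D? r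
  ... | yes j<count′ | _ = let (w , w<r , dw , eq) = count-hit r j j<count′ in w , NP.m<n⇒m<1+n w<r , dw , eq
  ... | no j≮count   | yes dr = r , NP.≤-refl , dr ,
          NP.≤-antisym (NP.≮⇒≥ j≮count) (NP.≤-pred (subst (j <_) (NP.+-comm (count r) 1) j<count))
  ... | no j≮count   | no _ = contradiction (subst (j <_) (NP.+-identityʳ _) j<count) j≮count

  count-absent-below : ∀ a → (∀ w → w < a → ¬ D w) → ∀ r → count r ≤ r ∸ a
  count-absent-below a absent zero = z≤n
  count-absent-below a absent (suc r) with D? r
  ... | no _ = NP.≤-trans (NP.≤-reflexive (NP.+-identityʳ _)) (NP.≤-trans (count-absent-below a absent r) (NP.∸-monoˡ-≤ a (NP.n≤1+n r)))
  ... | yes dr = subst (_≤ suc r ∸ a) (NP.+-comm 1 (count r))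
                   (subst (suc (count r) ≤_) (sym (NP.+-∸-assoc 1 a≤r)) (s≤s (count-absent-below a absent r)))
    where
      a≤r : a ≤ r
      a≤r = NP.≮⇒≥ (λ r<a → absent r r<a dr)

open Count using (count)

count-cover : ∀ {D₁ D₂ : ℕ → Set} (D₁? : ∀ w → Dec (D₁ w)) (D₂? : ∀ w → Dec (D₂ w)) a b →
  (∀ w → a ≤ w → w < b → D₁ w ⊎ D₂ w) → ∀ r → r ≤ b → r ∸ a ≤ count D₁? r + count D₂? r
count-cover D₁? D₂? a b covered zero    _   = NP.≤-reflexive (NP.0∸n≡0 a)
count-cover {D₁} {D₂} D₁? D₂? a b covered (suc r) r<b with a NP.≤? r
... | no a≰r = NP.≤-trans (NP.≤-reflexive (NP.m≤n⇒m∸n≡0 (NP.≰⇒> a≰r))) z≤n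
... | yes a≤r = subst (_≤ count D₁? (suc r) + count D₂? (suc r)) (sym (NP.+-∸-assoc 1 a≤r)) (step (covered r a≤r r<b))
  where
    c₁ = count D₁? r
    c₂ = count D₂? r
    ih : r ∸ a ≤ c₁ + c₂
    ih = count-cover D₁? D₂? a b covered r (NP.<⇒≤ r<b)
    step : D₁ r ⊎ D₂ r → suc (r ∸ a) ≤ count D₁? (suc r) + count D₂? (suc r)
    step (inj₁ d₁) = subst (λ w → suc (r ∸ a) ≤ w + count D₂? (suc r)) (sym (Count.count-suc-yes D₁? r d₁))
                       (s≤s (NP.≤-trans ih (NP.+-monoʳ-≤ c₁ (NP.m≤m+n c₂ _))))
    step (inj₂ d₂) = subst (λ w → suc (r ∸ a) ≤ count D₁? (suc r) + w) (sym (Count.count-suc-yes D₂? r d₂))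
                       (subst (suc (r ∸ a) ≤_) (sym (NP.+-suc _ c₂)) (s≤s (NP.≤-trans ih (NP.+-monoˡ-≤ c₂ (NP.m≤m+n c₁ _)))))

∑indicator-zero : ∀ n {R : Fin n → Set} (R? : ∀ x → Dec (R x)) → (∀ x → ¬ R x) → ∑[ x < n ] indicator (R? x) ≡ 0
∑indicator-zero zero    R? ¬R = refl
∑indicator-zero (suc n) R? ¬R = cong₂ _+_ (indicator-no (¬R F.zero) (R? F.zero)) (∑indicator-zero n (R? ∘ F.suc) (¬R ∘ F.suc))

∑indicator-atMostOne : ∀ n {R : Fin n → Set} (R? : ∀ x → Dec (R x)) → (∀ x y → R x → R y → x ≡ y) →
  (d : Dec (∃ R)) → ∑[ x < n ] indicator (R? x) ≡ indicator d
∑indicator-atMostOne zero    R? unique d = sym (indicator-no (λ ()) d)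
∑indicator-atMostOne (suc n) {R} R? unique d with R? F.zero
... | yes r₀ = trans (cong suc (∑indicator-zero n (R? ∘ F.suc) (λ x r → FP.0≢1+n (unique _ _ r₀ r)))) (sym (indicator-yes (F.zero , r₀) d))
... | no ¬r₀ = trans (∑indicator-atMostOne n (R? ∘ F.suc) (λ x y rx ry → FP.suc-injective (unique _ _ rx ry)) (FP.any? (R? ∘ F.suc)))
                     (indicator-cong (mk⇔ (λ (x , r) → F.suc x , r) fromSuc) _ d)
  where
    fromSuc : ∃ R → ∃ (R ∘ F.suc)
    fromSuc (F.zero  , r) = contradiction r ¬r₀
    fromSuc (F.suc x , r) = x , r

∣p∣≡∑indicator : ∀ {n} (p : Subset n) → ∣ p ∣ ≡ ∑[ x < n ] indicator (x ∈? p)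
∣p∣≡∑indicator []            = refl
∣p∣≡∑indicator {suc n} (inside ∷ p) = cong suc (trans (∣p∣≡∑indicator p) (sum-cong-≗ {n} (λ x → indicator-cong (mk⇔ there drop) _ _)))
  where drop : ∀ {x} → F.suc x ∈ inside ∷ p → x ∈ p
        drop (there x∈p) = x∈p
∣p∣≡∑indicator {suc n} (outside ∷ p) = trans (∣p∣≡∑indicator p) (sum-cong-≗ {n} (λ x → indicator-cong (mk⇔ there drop) _ _))
  where drop : ∀ {x} → F.suc x ∈ outside ∷ p → x ∈ p
        drop (there x∈p) = x∈p

indicator-⊎ : {A B C : Set} → A ⇔ (B ⊎ C) → (B → ¬ C) → (a : Dec A) (b : Dec B) (c : Dec C) →
  indicator a ≡ indicator b + indicator c
indicator-⊎ A⇔B⊎C B→¬C (yes x) (yes y) c = cong suc (sym (indicator-no (B→¬C y) c))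
indicator-⊎ A⇔B⊎C B→¬C (yes x) (no ¬y) c with to A⇔B⊎C x
... | inj₁ y = contradiction y ¬y
... | inj₂ z = sym (indicator-yes z c)
indicator-⊎ A⇔B⊎C B→¬C (no ¬x) b c =
  sym (cong₂ _+_ (indicator-no (¬x ∘ from A⇔B⊎C ∘ inj₁) b) (indicator-no (¬x ∘ from A⇔B⊎C ∘ inj₂) c))

∑indicator-image : ∀ n {B : Fin n → Set} (B? : ∀ x → Dec (B x)) (g : Fin n → ℕ) →
  (∀ x y → B x → B y → g x ≡ g y → x ≡ y) → ∀ r →
  ∑[ x < n ] indicator (B? x ×-dec (g x NP.<? r)) ≡ count (λ o → FP.any? (λ x → B? x ×-dec (g x NP.≟ o))) r
∑indicator-image n B? g injective zero = ∑indicator-zero n _ (λ x (_ , gx<0) → NP.n≮0 gx<0)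
∑indicator-image n {B} B? g injective (suc r) = begin
  ∑[ x < n ] indicator (B? x ×-dec (g x NP.<? suc r))
    ≡⟨ sum-cong-≗ {n} (λ x → indicator-⊎ (split x) (λ (_ , gx<r) (_ , gx≡r) → NP.<⇒≢ gx<r gx≡r)
                                         (B? x ×-dec (g x NP.<? suc r)) (B? x ×-dec (g x NP.<? r)) (B? x ×-dec (g x NP.≟ r))) ⟩
  ∑[ x < n ] (indicator (B? x ×-dec (g x NP.<? r)) + indicator (B? x ×-dec (g x NP.≟ r)))
    ≡⟨ ∑-distrib-+ {n} _ _ ⟩
  ∑[ x < n ] indicator (B? x ×-dec (g x NP.<? r)) + ∑[ x < n ] indicator (B? x ×-dec (g x NP.≟ r))
    ≡⟨ cong₂ _+_ (∑indicator-image n B? g injective r)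
                 (∑indicator-atMostOne n _ (λ x y (bx , gx≡r) (by , gy≡r) → injective x y bx by (trans gx≡r (sym gy≡r))) _) ⟩
  count (λ o → FP.any? (λ x → B? x ×-dec (g x NP.≟ o))) (suc r) ∎
  where
    open ≡-Reasoning
    split : ∀ x → (B x × g x < suc r) ⇔ ((B x × g x < r) ⊎ (B x × g x ≡ r))
    split x = mk⇔ (λ (bx , gx<1+r) → Data.Sum.map (bx ,_) (bx ,_) (NP.m<1+n⇒m<n∨m≡n gx<1+r))
                  (λ { (inj₁ (bx , gx<r)) → bx , NP.m<n⇒m<1+n gx<r ; (inj₂ (bx , refl)) → bx , NP.≤-refl })

m<o+n⇒m∸n<o : ∀ m n o → n ≤ m → m < o + n → m ∸ n < o
m<o+n⇒m∸n<o m n o n≤m m<o+n = NP.+-cancelʳ-< n (m ∸ n) o (subst (_< o + n) (sym (NP.m∸n+n≡m n≤m)) m<o+n)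

-- Were e = d % Q nonzero, the offset Q ∸ e would land on 0 < k, forcing Q ∸ e < k; but then k lands on k + e ∸ Q < k.
rotation-fixing-prefix⇒∣ : ∀ {Q} .{{_ : NonZero Q}} {k d} → 1 ≤ k → k < Q →
  (∀ o → o < Q → (o + d) % Q < k → o < k) → Q ∣ d
rotation-fixing-prefix⇒∣ {Q} {k} {d} 1≤k k<Q stable with d % Q NP.≟ 0
... | yes d%Q≡0 = m%n≡0⇒n∣m d Q d%Q≡0
... | no  d%Q≢0 = contradiction (stable k k<Q k+d%Q<k) (NP.<-irrefl refl)
  where
    e = d % Q
    e<Q : e < Q
    e<Q = m%n<n d Q
    shift : ∀ o → o < Q → (o + d) % Q ≡ (o + e) % Q
    shift o o<Q = trans (%-distribˡ-+ o d Q) (cong (λ w → (w + e) % Q) (m<n⇒m%n≡m o<Q))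
    o₁ = Q ∸ e
    o₁+e≡Q : o₁ + e ≡ Q
    o₁+e≡Q = NP.m∸n+n≡m (NP.<⇒≤ e<Q)
    o₁<Q : o₁ < Q
    o₁<Q = NP.∸-monoʳ-< {Q} {e} {0} (NP.n≢0⇒n>0 d%Q≢0) (NP.<⇒≤ e<Q)
    o₁<k : o₁ < k
    o₁<k = stable o₁ o₁<Q (subst (_< k) (sym (trans (shift o₁ o₁<Q) (trans (cong (_% Q) o₁+e≡Q) (n%n≡0 Q)))) 1≤k)
    Q≤k+e : Q ≤ k + e
    Q≤k+e = NP.<⇒≤ (subst (_< k + e) o₁+e≡Q (NP.+-monoˡ-< e o₁<k))
    k+e∸Q<k : k + e ∸ Q < k
    k+e∸Q<k = m<o+n⇒m∸n<o (k + e) Q k Q≤k+e (NP.+-monoʳ-< k e<Q)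
    k+d%Q<k : (k + d) % Q < k
    k+d%Q<k = subst (_< k) (sym (trans (shift k k<Q) (trans (sym (m≤n⇒[n∸m]%m≡n%m Q≤k+e)) (m<n⇒m%n≡m (NP.<-trans k+e∸Q<k k<Q))))) k+e∸Q<k

¬T⇒≡false : ∀ {b} → ¬ T b → b ≡ false
¬T⇒≡false {false} _  = refl
¬T⇒≡false {true}  ¬t = contradiction tt ¬t

just≢nothing : ∀ {A : Set} {a : ℕ} {v} → v ≡ just a → v ≡ nothing → A
just≢nothing refl ()

T-not : ∀ {b} → T (not b) ⇔ (¬ T b)
T-not {false} = mk⇔ (λ _ ()) (λ _ → tt)
T-not {true}  = mk⇔ (λ ()) (λ ¬t → ¬t tt)

module Order {n : ℕ} (P : FinPoset n) where
  open FinPoset P public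
  open IsPartialOrder isPartialOrder public using (antisym) renaming (refl to ≼-refl; trans to ≼-trans)

  infix 4 _≺ₚ_ _⋖ₚ_
  _≺ₚ_ : Fin n → Fin n → Set
  _≺ₚ_ = _≺_ P

  _⋖ₚ_ : Fin n → Fin n → Set
  _⋖ₚ_ = _⋖_ P

  ≺-irrefl : ∀ {x} → ¬ (x ≺ₚ x)
  ≺-irrefl (_ , x≢x) = x≢x refl

  ≺-≼-trans : ∀ {x y z} → x ≺ₚ y → y ≼ z → x ≺ₚ z
  ≺-≼-trans (x≼y , x≢y) y≼z = ≼-trans x≼y y≼z , λ { refl → x≢y (antisym x≼y y≼z) }

  ≺-trans : ∀ {x y z} → x ≺ₚ y → y ≺ₚ z → x ≺ₚ z
  ≺-trans x≺y (y≼z , _) = ≺-≼-trans x≺y y≼z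

  ≼⇒≡⊎≺ : ∀ {x y} → x ≼ y → x ≡ y ⊎ x ≺ₚ y
  ≼⇒≡⊎≺ {x} {y} x≼y with x F.≟ y
  ... | yes x≡y = inj₁ x≡y
  ... | no  x≢y = inj₂ (x≼y , x≢y)

  _≺?_ : ∀ x y → Dec (x ≺ₚ y)
  x ≺? y = (x ≼? y) ×-dec ¬? (x F.≟ y)

  _⋖?_ : ∀ x y → Dec (x ⋖ₚ y)
  x ⋖? y = (x ≺? y) ×-dec (FP.all? λ z → ¬? ((x ≺? z) ×-dec (z ≺? y)))

  T-anyFin : ∀ {p} → T (anyFin P p) ⇔ ∃ (T ∘ p)
  T-anyFin {p} = mk⇔ (satisfied ∘ any⁻ p (allFin n)) (λ (x , px) → any⁺ p (lose (∈-allFin x) px))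

  T-<ᵇ : ∀ {x y} → T (_<ᵇ_ P x y) ⇔ x ≺ₚ y
  T-<ᵇ {x} {y} = mk⇔
    (λ t → let (t₁ , t₂) = to T-∧ t in toWitness {a? = x ≼? y} t₁ , toWitnessFalse {a? = x F.≟ y} t₂)
    (λ (x≼y , x≢y) → from T-∧ (fromWitness {a? = x ≼? y} x≼y , fromWitnessFalse {a? = x F.≟ y} x≢y))

  T-⋖ᵇ : ∀ {x y} → T (_⋖ᵇ_ P x y) ⇔ x ⋖ₚ y
  T-⋖ᵇ {x} {y} = mk⇔
    (λ t → let (t₁ , t₂) = to T-∧ t in
      to T-<ᵇ t₁ , λ z (x≺z , z≺y) → to T-not t₂ (from T-anyFin (z , from T-∧ (from T-<ᵇ x≺z , from T-<ᵇ z≺y))))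
    (λ (x≺y , nothing-between) → from T-∧ (from T-<ᵇ x≺y , from T-not λ t →
      let (z , t′) = to T-anyFin t ; (t₁ , t₂) = to T-∧ t′ in nothing-between z (to T-<ᵇ t₁ , to T-<ᵇ t₂)))

  LabelAbove : ℕ → (Fin n → Maybe ℕ) → Fin n → Set
  LabelAbove i s z = ∃ λ y → z ⋖ₚ y × s y ≡ just i

  HoleBelow : (Fin n → Maybe ℕ) → Fin n → Set
  HoleBelow s z = ∃ λ x → x ⋖ₚ z × s x ≡ nothing

  labelAbove? : ∀ i s z → Dec (LabelAbove i s z)
  labelAbove? i s z = FP.any? λ y → (z ⋖? y) ×-dec MP.≡-dec NP._≟_ (s y) (just i)

  holeBelow? : ∀ s z → Dec (HoleBelow s z)
  holeBelow? s z = FP.any? λ x → (x ⋖? z) ×-dec MP.≡-dec NP._≟_ (s x) nothing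

  private
    T-labeledWith : ∀ {i v} → T (labeledWith P i v) ⇔ v ≡ just i
    T-labeledWith {i} {nothing} = mk⇔ (λ ()) (λ ())
    T-labeledWith {i} {just j}  = mk⇔ (cong just ∘ NP.≡ᵇ⇒≡ j i) (λ { refl → NP.≡⇒≡ᵇ j j refl })

    T-is-nothing : ∀ {v : Maybe ℕ} → T (is-nothing v) ⇔ v ≡ nothing
    T-is-nothing {nothing} = mk⇔ (λ _ → refl) (λ _ → tt)
    T-is-nothing {just _}  = mk⇔ (λ ()) (λ ())

    T-labelAbove : ∀ {i s z} → T (anyFin P λ y → _⋖ᵇ_ P z y ∧ labeledWith P i (s y)) ⇔ LabelAbove i s z
    T-labelAbove = mk⇔
      (λ t → let (y , t′) = to T-anyFin t ; (t₁ , t₂) = to T-∧ t′ in y , to T-⋖ᵇ t₁ , to T-labeledWith t₂)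
      (λ (y , c , sy) → from T-anyFin (y , from T-∧ (from T-⋖ᵇ c , from T-labeledWith sy)))

    T-holeBelow : ∀ {s z} → T (anyFin P λ x → _⋖ᵇ_ P x z ∧ is-nothing (s x)) ⇔ HoleBelow s z
    T-holeBelow = mk⇔
      (λ t → let (x , t′) = to T-anyFin t ; (t₁ , t₂) = to T-∧ t′ in x , to T-⋖ᵇ t₁ , to T-is-nothing t₂)
      (λ (x , c , sx) → from T-anyFin (x , from T-∧ (from T-⋖ᵇ c , from T-is-nothing sx)))

  kStep-keep : ∀ {i a} s z → s z ≡ just a → a ≢ i → kStep P i s z ≡ just a
  kStep-keep {i} {a} s z sz a≢i rewrite sz | ¬T⇒≡false (a≢i ∘ NP.≡ᵇ⇒≡ a i) = refl

  kStep-slide : ∀ {i} s z → s z ≡ just i → HoleBelow s z → kStep P i s z ≡ nothing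
  kStep-slide {i} s z sz hole
    rewrite sz | to T-≡ (NP.≡⇒≡ᵇ i i refl) | to T-≡ (from (T-holeBelow {s} {z}) hole) = refl

  kStep-stay : ∀ {i} s z → s z ≡ just i → ¬ HoleBelow s z → kStep P i s z ≡ just i
  kStep-stay {i} s z sz ¬hole
    rewrite sz | to T-≡ (NP.≡⇒≡ᵇ i i refl) | ¬T⇒≡false (¬hole ∘ to (T-holeBelow {s} {z})) = refl

  kStep-fill : ∀ {i} s z → s z ≡ nothing → LabelAbove i s z → kStep P i s z ≡ just i
  kStep-fill {i} s z sz above rewrite sz | to T-≡ (from (T-labelAbove {i} {s} {z}) above) = refl

  kStep-empty : ∀ {i} s z → s z ≡ nothing → ¬ LabelAbove i s z → kStep P i s z ≡ nothing
  kStep-empty {i} s z sz ¬above rewrite sz | ¬T⇒≡false (¬above ∘ to (T-labelAbove {i} {s} {z})) = refl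

  data JustAfter (i : ℕ) (s : Fin n → Maybe ℕ) (x : Fin n) (a : ℕ) : Set where
    kept   : s x ≡ just a → a ≢ i → JustAfter i s x a
    stayed : s x ≡ just a → a ≡ i → ¬ HoleBelow s x → JustAfter i s x a
    filled : s x ≡ nothing → a ≡ i → JustAfter i s x a

  data NothingAfter (i : ℕ) (s : Fin n → Maybe ℕ) (x : Fin n) : Set where
    slid     : s x ≡ just i → NothingAfter i s x
    unfilled : s x ≡ nothing → ¬ LabelAbove i s x → NothingAfter i s x

  justAfter : ∀ i s x {a} → kStep P i s x ≡ just a → JustAfter i s x a
  justAfter i s x {a} after = go (s x) refl
    where
      go : ∀ v → s x ≡ v → JustAfter i s x a
      go nothing sx with labelAbove? i s x
      ... | yes above = filled sx (just-injective (trans (sym after) (kStep-fill s x sx above)))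
      ... | no ¬above = just≢nothing after (kStep-empty s x sx ¬above)
      go (just b) sx with b NP.≟ i
      ... | no b≢i = kept (trans sx (cong just b≡a)) (λ a≡i → b≢i (trans b≡a a≡i))
        where b≡a = just-injective (trans (sym (kStep-keep s x sx b≢i)) after)
      ... | yes refl with holeBelow? s x
      ...   | yes hole = just≢nothing after (kStep-slide s x sx hole)
      ...   | no ¬hole = stayed (trans sx (cong just b≡a)) (sym b≡a) ¬hole
        where b≡a = just-injective (trans (sym (kStep-stay s x sx ¬hole)) after)

  nothingAfter : ∀ i s x → kStep P i s x ≡ nothing → NothingAfter i s x
  nothingAfter i s x after = go (s x) refl
    where
      go : ∀ v → s x ≡ v → NothingAfter i s x
      go nothing sx with labelAbove? i s x
      ... | yes above = just≢nothing (kStep-fill s x sx above) after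
      ... | no ¬above = unfilled sx ¬above
      go (just b) sx with b NP.≟ i
      ... | no b≢i = just≢nothing (kStep-keep s x sx b≢i) after
      ... | yes refl with holeBelow? s x
      ...   | yes hole = slid sx
      ...   | no ¬hole = just≢nothing (kStep-stay s x sx ¬hole) after

  StrictlyMonotone : (Fin n → ℕ) → Set
  StrictlyMonotone L = ∀ x y → x ≺ₚ y → L x < L y

  -- A strictly monotone labelling bounds the length of chains, so covers exist below and above.
  module Covers (L : Fin n → ℕ) (mono : StrictlyMonotone L) where

    private
      bound-step : ∀ {x z y} N → x ≺ₚ z → L y ≤ L x + suc N → L y ≤ L z + N
      bound-step {x} {z} N x≺z bound = NP.≤-trans bound (subst (_≤ L z + N) (sym (NP.+-suc (L x) N)) (NP.+-monoˡ-≤ N (mono x z x≺z)))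

      no-gap : ∀ {x y} → x ≺ₚ y → ¬ (L y ≤ L x + 0)
      no-gap {x} {y} x≺y bound = NP.<⇒≱ (mono x y x≺y) (subst (L y ≤_) (NP.+-identityʳ (L x)) bound)

      below : ∀ N {x y} → L y ≤ L x + N → x ≺ₚ y → ∃ λ w → x ≼ w × w ⋖ₚ y
      below zero    bound x≺y = contradiction bound (no-gap x≺y)
      below (suc N) {x} {y} bound x≺y with FP.any? (λ z → (x ≺? z) ×-dec (z ≺? y))
      ... | no none = x , ≼-refl , x≺y , λ z between → none (z , between)
      ... | yes (z , x≺z , z≺y) with below N (bound-step N x≺z bound) z≺y
      ...   | w , z≼w , w⋖y = w , ≼-trans (proj₁ x≺z) z≼w , w⋖y

      above : ∀ N {x y} → L y ≤ L x + N → x ≺ₚ y → ∃ λ w → x ⋖ₚ w × w ≼ y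
      above zero    bound x≺y = contradiction bound (no-gap x≺y)
      above (suc N) {x} {y} bound x≺y with FP.any? (λ z → (x ≺? z) ×-dec (z ≺? y))
      ... | no none = y , (x≺y , λ z between → none (z , between)) , ≼-refl
      ... | yes (z , x≺z , z≺y) with above N (NP.≤-pred (NP.<-≤-trans (mono z y z≺y) (subst (L y ≤_) (NP.+-suc (L x) N) bound))) x≺z
      ...   | w , x⋖w , w≼z = w , x⋖w , ≼-trans w≼z (proj₁ z≺y)

    cover-below : ∀ {x y} → x ≺ₚ y → ∃ λ w → x ≼ w × w ⋖ₚ y
    cover-below {x} {y} = below (L y) (NP.m≤n+m (L y) (L x))

    cover-above : ∀ {x y} → x ≺ₚ y → ∃ λ w → x ⋖ₚ w × w ≼ y
    cover-above {x} {y} = above (L y) (NP.m≤n+m (L y) (L x))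

module PackedLabeling {n : ℕ} (P : FinPoset n) {m : ℕ} {L : Fin n → ℕ} (packed : IsPackedLabeling P m L) where
  L-range : ∀ x → 1 ≤ L x × L x ≤ m
  L-range = proj₁ packed

  L-onto : ∀ v → 1 ≤ v → v ≤ m → ∃ λ x → L x ≡ v
  L-onto = proj₁ (proj₂ packed)

  L-mono : Order.StrictlyMonotone P L
  L-mono = proj₂ (proj₂ packed)

module Promotion {n : ℕ} (P : FinPoset n) where
  open Order P

  IsPackedLabeling-cong : ∀ {m L L′} → (∀ x → L x ≡ L′ x) → IsPackedLabeling P m L → IsPackedLabeling P m L′
  IsPackedLabeling-cong {m} L≗L′ (range , onto , mono) =
    (λ x → subst (λ v → 1 ≤ v × v ≤ m) (L≗L′ x) (range x)) ,
    (λ v 1≤v v≤m → let (x , Lx≡v) = onto v 1≤v v≤m in x , trans (sym (L≗L′ x)) Lx≡v) ,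
    (λ x y x≺y → subst₂ _<_ (L≗L′ x) (L≗L′ y) (mono x y x≺y))

  -- Stage j is the state after labels 2, …, j+1 have been processed; kPromotion processes 2, …, m.
  module Stages (m : ℕ) (L : Fin n → ℕ) where

    initial : Fin n → Maybe ℕ
    initial x = if L x ≡ᵇ 1 then nothing else just (L x)

    stage : ℕ → Fin n → Maybe ℕ
    stage zero    = initial
    stage (suc j) = kStep P (2 + j) (stage j)

    finalize : Maybe ℕ → ℕ
    finalize nothing  = m
    finalize (just a) = a ∸ 1

    private
      foldl-steps≡stage : ∀ j → foldl (λ s i → kStep P i s) initial (map (2 +_) (upTo j)) ≡ stage j
      foldl-steps≡stage zero    = refl
      foldl-steps≡stage (suc j) = begin
        foldl step initial (map (2 +_) (upTo (suc j)))       ≡⟨ cong (foldl step initial ∘′ map (2 +_)) (LP.upTo-∷ʳ j) ⟨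
        foldl step initial (map (2 +_) (upTo j ∷ʳ j))         ≡⟨ cong (foldl step initial) (LP.map-++ (2 +_) (upTo j) (j ∷ [])) ⟩
        foldl step initial (map (2 +_) (upTo j) ∷ʳ (2 + j))   ≡⟨ LP.foldl-∷ʳ step initial (2 + j) (map (2 +_) (upTo j)) ⟩
        kStep P (2 + j) (foldl step initial (map (2 +_) (upTo j)))  ≡⟨ cong (kStep P (2 + j)) (foldl-steps≡stage j) ⟩
        stage (suc j)                                         ∎
        where
          open ≡-Reasoning
          step : (Fin n → Maybe ℕ) → ℕ → Fin n → Maybe ℕ
          step s i = kStep P i s

      kPromotion≡finalize-foldl : ∀ x → kPromotion P m L x ≡ finalize (foldl (λ s i → kStep P i s) initial (map (2 +_) (upTo (m ∸ 1))) x)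
      kPromotion≡finalize-foldl x with foldl (λ s i → kStep P i s) initial (map (2 +_) (upTo (m ∸ 1))) x
      ... | nothing = refl
      ... | just a  = refl

    kPromotion≡finalize : ∀ x → kPromotion P m L x ≡ finalize (stage (m ∸ 1) x)
    kPromotion≡finalize x = trans (kPromotion≡finalize-foldl x) (cong (λ s → finalize (s x)) (foldl-steps≡stage (m ∸ 1)))

    initial-cases : ∀ x → (L x ≡ 1 × initial x ≡ nothing) ⊎ (L x ≢ 1 × initial x ≡ just (L x))
    initial-cases x with L x ≡ᵇ 1 in eq
    ... | true  = inj₁ (NP.≡ᵇ⇒≡ (L x) 1 (subst T (sym eq) _) , refl)
    ... | false = inj₂ ((λ Lx≡1 → subst T eq (NP.≡⇒≡ᵇ (L x) 1 Lx≡1)) , refl)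

    stage-settled : ∀ {j x a} → stage j x ≡ just a → a ≤ suc j → ∀ d → stage (d + j) x ≡ just a
    stage-settled sx a≤1+j zero    = sx
    stage-settled {j} {x} sx a≤1+j (suc d) =
      kStep-keep (stage (d + j)) x (stage-settled sx a≤1+j d) (λ { refl → NP.<-irrefl refl (NP.≤-trans a≤1+j (NP.≤-trans (NP.m≤n+m (suc j) d) (NP.≤-reflexive (NP.+-suc d j)))) })

    stage-hole-later : ∀ {j x} → stage j x ≡ nothing → ∀ d →
      stage (d + j) x ≡ nothing ⊎ ∃ λ a → stage (d + j) x ≡ just a × 2 + j ≤ a
    stage-hole-later hole zero = inj₁ hole
    stage-hole-later {j} {x} hole (suc d) with stage-hole-later hole d
    ... | inj₁ hole′ with labelAbove? (2 + (d + j)) (stage (d + j)) x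
    ...   | yes above = inj₂ (_ , kStep-fill (stage (d + j)) x hole′ above , s≤s (s≤s (NP.m≤n+m j d)))
    ...   | no ¬above = inj₁ (kStep-empty (stage (d + j)) x hole′ ¬above)
    stage-hole-later {j} {x} hole (suc d) | inj₂ (a , sx , 2+j≤a) with a NP.≟ 2 + (d + j)
    ...   | no a≢i = inj₂ (a , kStep-keep (stage (d + j)) x sx a≢i , 2+j≤a)
    ...   | yes refl with holeBelow? (stage (d + j)) x
    ...     | yes hole″ = inj₁ (kStep-slide (stage (d + j)) x sx hole″)
    ...     | no ¬hole  = inj₂ (a , kStep-stay (stage (d + j)) x sx ¬hole , 2+j≤a)

    record StageInvariant (j : ℕ) : Set where
      field
        inRange           : ∀ {x a} → stage j x ≡ just a → 2 ≤ a × a ≤ m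
        increasing        : ∀ {x y a b} → x ≺ₚ y → stage j x ≡ just a → stage j y ≡ just b → a < b
        aboveHole         : ∀ {x y b} → x ≺ₚ y → stage j x ≡ nothing → stage j y ≡ just b → 2 + j ≤ b
        belowHole         : ∀ {x y a} → x ≺ₚ y → stage j x ≡ just a → stage j y ≡ nothing → a ≤ 1 + j
        holesIncomparable : ∀ {x y} → x ≺ₚ y → stage j x ≡ nothing → stage j y ≡ nothing → ⊥
        holeExists        : ∃ λ x → stage j x ≡ nothing
        surjective        : ∀ a → 2 ≤ a → a ≤ m → ∃ λ x → stage j x ≡ just a
        originalOrSettled : ∀ {x a} → stage j x ≡ just a → a ≡ L x ⊎ a ≤ 1 + j
        unprocessed       : ∀ x → 1 + j < L x → stage j x ≡ just (L x)

    module _ (packed : IsPackedLabeling P m L) (1≤m : 1 ≤ m) where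
      open PackedLabeling P packed
      private
        initial-just : ∀ {x a} → initial x ≡ just a → a ≡ L x × L x ≢ 1
        initial-just {x} ix with initial-cases x
        ... | inj₁ (_ , ix′) = just≢nothing ix ix′
        ... | inj₂ (Lx≢1 , ix′) = just-injective (trans (sym ix) ix′) , Lx≢1

        initial-nothing : ∀ {x} → initial x ≡ nothing → L x ≡ 1
        initial-nothing {x} ix with initial-cases x
        ... | inj₁ (Lx≡1 , _) = Lx≡1
        ... | inj₂ (_ , ix′) = just≢nothing ix′ ix

        initial-hole : ∀ {x} → L x ≡ 1 → initial x ≡ nothing
        initial-hole {x} Lx≡1 with initial-cases x
        ... | inj₁ (_ , ix) = ix
        ... | inj₂ (Lx≢1 , _) = contradiction Lx≡1 Lx≢1

        initial-unprocessed : ∀ x → 1 < L x → initial x ≡ just (L x)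
        initial-unprocessed x 1<Lx with initial-cases x
        ... | inj₁ (Lx≡1 , _) = contradiction (sym Lx≡1) (NP.<⇒≢ 1<Lx)
        ... | inj₂ (_ , ix) = ix

        1≤∧≢1⇒2≤ : ∀ {v} → 1 ≤ v → v ≢ 1 → 2 ≤ v
        1≤∧≢1⇒2≤ {suc zero}    _ v≢1 = contradiction refl v≢1
        1≤∧≢1⇒2≤ {suc (suc v)} _ _   = s≤s (s≤s z≤n)

      open Covers L L-mono

      invariant₀ : StageInvariant 0
      invariant₀ = record
        { inRange           = λ {x} ix → let (a≡Lx , Lx≢1) = initial-just ix in
                                subst (λ v → 2 ≤ v × v ≤ m) (sym a≡Lx) (1≤∧≢1⇒2≤ (proj₁ (L-range x)) Lx≢1 , proj₂ (L-range x))
        ; increasing        = λ {x} {y} x≺y ix iy → subst₂ _<_ (sym (proj₁ (initial-just ix))) (sym (proj₁ (initial-just iy))) (L-mono x y x≺y)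
        ; aboveHole         = λ {x} {y} x≺y ix iy → subst (2 ≤_) (sym (proj₁ (initial-just iy))) (subst (_< L y) (initial-nothing ix) (L-mono x y x≺y))
        ; belowHole         = λ {x} {y} x≺y ix iy → contradiction (subst (L x <_) (initial-nothing iy) (L-mono x y x≺y)) (NP.<⇒≱ (s≤s (proj₁ (L-range x))))
        ; holesIncomparable = λ {x} {y} x≺y ix iy → NP.<-irrefl (trans (initial-nothing ix) (sym (initial-nothing iy))) (L-mono x y x≺y)
        ; holeExists        = let (x , Lx≡1) = L-onto 1 NP.≤-refl 1≤m in x , initial-hole Lx≡1
        ; surjective        = λ a 2≤a a≤m → let (x , Lx≡a) = L-onto a (NP.<⇒≤ 2≤a) a≤m in
                                x , subst (λ v → initial x ≡ just v) Lx≡a (initial-unprocessed x (subst (1 <_) (sym Lx≡a) 2≤a))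
        ; originalOrSettled = λ ix → inj₁ (proj₁ (initial-just ix))
        ; unprocessed       = initial-unprocessed
        }

      module _ {j : ℕ} (2+j≤m : 2 + j ≤ m) (I : StageInvariant j) where
        open StageInvariant I
        private
          s = stage j
          i = 2 + j

          hole-under-stayer : ∀ {x y} → x ≺ₚ y → s x ≡ nothing → s y ≡ just i → HoleBelow s y
          hole-under-stayer {x} {y} x≺y sx sy with cover-below x≺y
          ... | w , x≼w , w⋖y with s w in sw
          ...   | nothing = w , w⋖y , sw
          ...   | just c with ≼⇒≡⊎≺ x≼w
          ...     | inj₁ refl = just≢nothing sw sx
          ...     | inj₂ x≺w  = contradiction (increasing (proj₁ w⋖y) sw sy) (NP.≤⇒≯ (aboveHole x≺w sx sw))

          label-above-hole : ∀ {x y} → x ≺ₚ y → s x ≡ nothing → s y ≡ just i → LabelAbove i s x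
          label-above-hole {x} {y} x≺y sx sy with cover-above x≺y
          ... | w , x⋖w , w≼y with ≼⇒≡⊎≺ w≼y
          ...   | inj₁ refl = w , x⋖w , sy
          ...   | inj₂ w≺y with s w in sw
          ...     | nothing = contradiction sw (holesIncomparable (proj₁ x⋖w) sx)
          ...     | just c  = contradiction (increasing w≺y sw sy) (NP.≤⇒≯ (aboveHole (proj₁ x⋖w) sx sw))

        invariant-step : StageInvariant (suc j)
        StageInvariant.inRange invariant-step after with justAfter i s _ after
        ... | kept sx _       = inRange sx
        ... | stayed sx _ _   = inRange sx
        ... | filled _ refl   = s≤s (s≤s z≤n) , 2+j≤m
        StageInvariant.increasing invariant-step x≺y afterx aftery with justAfter i s _ afterx | justAfter i s _ aftery
        ... | kept sx _      | kept sy _      = increasing x≺y sx sy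
        ... | kept sx _      | stayed sy _ _  = increasing x≺y sx sy
        ... | stayed sx _ _  | kept sy _      = increasing x≺y sx sy
        ... | stayed sx _ _  | stayed sy _ _  = increasing x≺y sx sy
        ... | kept sx _      | filled sy refl = s≤s (belowHole x≺y sx sy)
        ... | stayed sx _ _  | filled sy refl = s≤s (belowHole x≺y sx sy)
        ... | filled sx refl | kept sy b≢i    = NP.≤∧≢⇒< (aboveHole x≺y sx sy) (b≢i ∘ sym)
        ... | filled sx refl | stayed sy refl ¬hole = contradiction (hole-under-stayer x≺y sx sy) ¬hole
        ... | filled sx _    | filled sy _    = contradiction sy (holesIncomparable x≺y sx)
        StageInvariant.aboveHole invariant-step x≺y afterx aftery with nothingAfter i s _ afterx | justAfter i s _ aftery
        ... | slid sx         | kept sy _      = increasing x≺y sx sy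
        ... | slid sx         | stayed sy _ _  = increasing x≺y sx sy
        ... | slid sx         | filled sy _    = contradiction (belowHole x≺y sx sy) (NP.<-irrefl refl ∘ s≤s)
        ... | unfilled sx _   | kept sy b≢i    = NP.≤∧≢⇒< (aboveHole x≺y sx sy) (b≢i ∘ sym)
        ... | unfilled sx _   | stayed sy refl ¬hole = contradiction (hole-under-stayer x≺y sx sy) ¬hole
        ... | unfilled sx _   | filled sy _    = contradiction sy (holesIncomparable x≺y sx)
        StageInvariant.belowHole invariant-step x≺y afterx aftery with justAfter i s _ afterx | nothingAfter i s _ aftery
        ... | stayed _ refl _ | _              = NP.≤-refl
        ... | filled _ refl   | _              = NP.≤-refl
        ... | kept sx _       | unfilled sy _  = NP.m≤n⇒m≤1+n (belowHole x≺y sx sy)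
        ... | kept sx _       | slid sy        = NP.<⇒≤ (increasing x≺y sx sy)
        StageInvariant.holesIncomparable invariant-step x≺y afterx aftery with nothingAfter i s _ afterx | nothingAfter i s _ aftery
        ... | unfilled sx _   | unfilled sy _  = holesIncomparable x≺y sx sy
        ... | unfilled sx ¬above | slid sy     = ¬above (label-above-hole x≺y sx sy)
        ... | slid sx         | unfilled sy _  = NP.<-irrefl refl (s≤s (belowHole x≺y sx sy))
        ... | slid sx         | slid sy        = NP.<-irrefl refl (increasing x≺y sx sy)
        StageInvariant.holeExists invariant-step with holeExists
        ... | x , sx with labelAbove? i s x
        ...   | no ¬above = x , kStep-empty s x sx ¬above
        ...   | yes (y , x⋖y , sy) = y , kStep-slide s y sy (x , x⋖y , sx)
        StageInvariant.surjective invariant-step a 2≤a a≤m with surjective a 2≤a a≤m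
        ... | x , sx with a NP.≟ i
        ...   | no a≢i = x , kStep-keep s x sx a≢i
        ...   | yes refl with holeBelow? s x
        ...     | no ¬hole = x , kStep-stay s x sx ¬hole
        ...     | yes (w , w⋖x , sw) = w , kStep-fill s w sw (x , w⋖x , sx)
        StageInvariant.originalOrSettled invariant-step after with justAfter i s _ after
        ... | kept sx _       = Data.Sum.map₂ NP.m≤n⇒m≤1+n (originalOrSettled sx)
        ... | stayed sx _ _   = Data.Sum.map₂ NP.m≤n⇒m≤1+n (originalOrSettled sx)
        ... | filled _ refl   = inj₂ NP.≤-refl
        StageInvariant.unprocessed invariant-step x 2+j<Lx =
          kStep-keep s x (unprocessed x (NP.<-trans (NP.n<1+n (1 + j)) 2+j<Lx)) (λ Lx≡i → NP.<-irrefl (sym Lx≡i) 2+j<Lx)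

      invariant : ∀ j → j ≤ m ∸ 1 → StageInvariant j
      invariant zero    _      = invariant₀
      invariant (suc j) 1+j≤m-1 = invariant-step (NP.≤-trans (s≤s 1+j≤m-1) (NP.≤-reflexive (NP.m+[n∸m]≡n 1≤m)))
                                        (invariant j (NP.≤-trans (NP.n≤1+n j) 1+j≤m-1))

      private
        final = stage (m ∸ 1)

        finalize-packed : IsPackedLabeling P m (finalize ∘ final)
        finalize-packed = range , onto , mono
          where
            open StageInvariant (invariant (m ∸ 1) NP.≤-refl)
            range : ∀ x → 1 ≤ finalize (final x) × finalize (final x) ≤ m
            range x with final x in fx
            ... | nothing = 1≤m , NP.≤-refl
            ... | just a  = NP.∸-monoˡ-≤ 1 (proj₁ (inRange fx)) , NP.≤-trans (NP.m∸n≤m a 1) (proj₂ (inRange fx))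
            onto : ∀ v → 1 ≤ v → v ≤ m → ∃ λ x → finalize (final x) ≡ v
            onto v 1≤v v≤m with v NP.≟ m
            ... | yes refl = let (x , fx) = holeExists in x , cong finalize fx
            ... | no v≢m   = let (x , fx) = surjective (suc v) (s≤s 1≤v) (NP.≤∧≢⇒< v≤m v≢m) in x , cong finalize fx
            mono : ∀ x y → x ≺ₚ y → finalize (final x) < finalize (final y)
            mono x y x≺y with final x in fx | final y in fy
            ... | just a  | just b  = NP.∸-monoˡ-< (increasing x≺y fx fy) (NP.≤-trans (s≤s z≤n) (proj₁ (inRange fx)))
            ... | just a  | nothing = NP.<-≤-trans (NP.∸-monoʳ-< {a} {1} {0} (s≤s z≤n) (NP.≤-trans (s≤s z≤n) (proj₁ (inRange fx)))) (proj₂ (inRange fx))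
            ... | nothing | just b  = contradiction (proj₂ (inRange fy))
                                        (NP.<⇒≱ (subst (_≤ b) (cong suc (NP.m+[n∸m]≡n 1≤m)) (aboveHole x≺y fx fy)))
            ... | nothing | nothing = contradiction fy (holesIncomparable x≺y fx)

      kPromotion-packed : IsPackedLabeling P m (kPromotion P m L)
      kPromotion-packed = IsPackedLabeling-cong (λ x → sym (kPromotion≡finalize x)) finalize-packed

  iter-kPromotion-packed : ∀ {m L} → 1 ≤ m → IsPackedLabeling P m L → ∀ d → IsPackedLabeling P m (iter d (kPromotion P m) L)
  iter-kPromotion-packed 1≤m packed zero    = packed
  iter-kPromotion-packed 1≤m packed (suc d) = Stages.kPromotion-packed _ _ (iter-kPromotion-packed 1≤m packed d) 1≤m

-- Trunk positions indexed by ℕ, so that induction along the trunk is structural.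
module TrunkIndexing {n : ℕ} (P : FinPoset n) (z : Fin n) where
  open Order P

  trunkAt : ∀ {t} (c : Fin t → Fin n) i → .(i < t) → Fin n
  trunkAt c i i<t = c (F.fromℕ< i<t)

  inTrunk-trunkAt : ∀ {t} (c : Fin t → Fin n) i .(i<t : i < t) → InTrunk P c (trunkAt c i i<t)
  inTrunk-trunkAt c i i<t = F.fromℕ< i<t , refl

  inTrunk⇒trunkAt : ∀ {t} (c : Fin t → Fin n) {x} → InTrunk P c x → ∃ λ i → Σ (i < t) λ i<t → trunkAt c i i<t ≡ x
  inTrunk⇒trunkAt c (j , cj≡x) = F.toℕ j , FP.toℕ<n j , trans (cong c (FP.fromℕ<-toℕ j (FP.toℕ<n j))) cj≡x

  inTrunk? : ∀ {t} (c : Fin t → Fin n) x → Dec (InTrunk P c x)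
  inTrunk? c x = FP.any? λ j → c j F.≟ x

  trunkAt-0 : ∀ {t} {c : Fin t → Fin n} → IsTrunkChain P z t c → .(0<t : 0 < t) → trunkAt c 0 0<t ≡ z
  trunkAt-0 {suc _} (c₀≡z , _) 0<t = c₀≡z

  trunkAt-⋖ : ∀ {t} {c : Fin t → Fin n} → IsTrunkChain P z t c →
    ∀ i .(i<t : i < t) .(1+i<t : suc i < t) → trunkAt c i i<t ⋖ₚ trunkAt c (suc i) 1+i<t
  trunkAt-⋖ {suc t} {c} (_ , covers , _) i i<t 1+i<t =
    subst (λ w → c w ⋖ₚ c (F.fromℕ< 1+i<t)) (FP.toℕ-injective toℕ-eq) (covers (F.fromℕ< (NP.≤-pred 1+i<t)))
    where
      toℕ-eq : F.toℕ (F.inject₁ (F.fromℕ< (NP.≤-pred 1+i<t))) ≡ F.toℕ (F.fromℕ< i<t)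
      toℕ-eq = trans (FP.toℕ-inject₁ _) (trans (FP.toℕ-fromℕ< _) (sym (FP.toℕ-fromℕ< _)))

  trunkAt-uniqueCover : ∀ {t} {c : Fin t → Fin n} → IsTrunkChain P z t c →
    ∀ i .(i<t : i < t) → CoveredByExactlyOne P (trunkAt c i i<t)
  trunkAt-uniqueCover {suc _} (_ , _ , unique) i i<t = unique (F.fromℕ< i<t)

module TrunkFacts {n : ℕ} (P : FinPoset n) (z : Fin n) (z-min : IsMinimum P z)
                  {t : ℕ} (c : Fin t → Fin n) (trunk : IsTrunkChain P z t c)
                  (z′ : Fin n) (z′-min : IsMinimumOfComplement P c z′)
                  (L₀ : Fin n → ℕ) (L₀-mono : Order.StrictlyMonotone P L₀) where
  open Order P
  open TrunkIndexing P z
  open Covers L₀ L₀-mono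

  -- c i is covered only by c (i+1), so anything above c i other than c (i+1) is above c (i+1).
  trunkAt-below : ∀ i .(i<t : i < t) y → (∀ j .(j<t : j < t) → j ≤ i → trunkAt c j j<t ≢ y) → trunkAt c i i<t ≺ₚ y
  trunkAt-below zero i<t y avoids =
    subst (_≺ₚ y) (sym (trunkAt-0 trunk i<t)) (z-min y , λ z≡y → avoids 0 i<t z≤n (trans (trunkAt-0 trunk i<t) z≡y))
  trunkAt-below (suc i) 1+i<t y avoids
    with cover-above (trunkAt-below i (NP.<-trans (NP.n<1+n i) 1+i<t) y λ j j<t j≤i → avoids j j<t (NP.m≤n⇒m≤1+n j≤i))
  ... | w , cᵢ⋖w , w≼y with trunkAt-uniqueCover trunk i (NP.<-trans (NP.n<1+n i) 1+i<t)
  ...   | _ , _ , unique =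
    subst (_≼ y) (sym (trans (unique _ (trunkAt-⋖ trunk i _ 1+i<t)) (sym (unique w cᵢ⋖w)))) w≼y ,
    avoids (suc i) 1+i<t NP.≤-refl

  z′∉trunk : ¬ InTrunk P c z′
  z′∉trunk = proj₁ z′-min

  trunk≺z′ : ∀ {x} → InTrunk P c x → x ≺ₚ z′
  trunk≺z′ x∈trunk with inTrunk⇒trunkAt c x∈trunk
  ... | i , i<t , refl = trunkAt-below i i<t z′ λ j j<t _ cⱼ≡z′ → z′∉trunk (subst (InTrunk P c) cⱼ≡z′ (inTrunk-trunkAt c j j<t))

  Upper : Fin n → Set
  Upper = InQ P c z′

  Upper⇒z′≺ : ∀ {x} → Upper x → z′ ≺ₚ x
  Upper⇒z′≺ {x} (x∉trunk , x≢z′) = proj₂ z′-min x x∉trunk , x≢z′ ∘ sym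

  z′≺⇒Upper : ∀ {x} → z′ ≺ₚ x → Upper x
  z′≺⇒Upper z′≺x = (λ x∈trunk → ≺-irrefl (≺-trans (trunk≺z′ x∈trunk) z′≺x)) , λ { refl → ≺-irrefl z′≺x }

  upper? : ∀ x → Dec (Upper x)
  upper? x = ¬? (inTrunk? c x) ×-dec ¬? (x F.≟ z′)

  module TrunkLabels {m : ℕ} (t<m : t < m) {L : Fin n → ℕ} (packed : IsPackedLabeling P m L) where
    open PackedLabeling P packed

    ≼⇒≤ : ∀ {x y} → x ≼ y → L x ≤ L y
    ≼⇒≤ x≼y with ≼⇒≡⊎≺ x≼y
    ... | inj₁ refl = NP.≤-refl
    ... | inj₂ x≺y  = NP.<⇒≤ (L-mono _ _ x≺y)

    private
      labels-upto : ∀ i → i < t → ∀ j .(j<t : j < t) → j ≤ i → L (trunkAt c j j<t) ≡ suc j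
      labels-upto zero 0<t zero j<t _ =
        let (x , Lx≡1) = L-onto 1 NP.≤-refl (NP.≤-trans (s≤s z≤n) t<m) in
        NP.≤-antisym (subst (λ w → L w ≤ 1) (sym (trunkAt-0 trunk j<t)) (subst (L z ≤_) Lx≡1 (≼⇒≤ (z-min x))))
                     (proj₁ (L-range _))
      labels-upto (suc i) 1+i<t j j<t j≤1+i with j NP.≟ suc i
      ... | no j≢1+i = labels-upto i (NP.<-trans (NP.n<1+n i) 1+i<t) j j<t (NP.≤-pred (NP.≤∧≢⇒< j≤1+i j≢1+i))
      ... | yes refl = NP.≤-antisym upper lower
        where
          i<t : i < t
          i<t = NP.<-trans (NP.n<1+n i) 1+i<t
          lower : suc (suc i) ≤ L (trunkAt c (suc i) j<t)
          lower = subst (_< L (trunkAt c (suc i) j<t)) (labels-upto i i<t i i<t NP.≤-refl) (L-mono _ _ (proj₁ (trunkAt-⋖ trunk i i<t j<t)))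
          x : Fin n
          x = proj₁ (L-onto (suc (suc i)) (s≤s z≤n) (NP.≤-trans 1+i<t (NP.<⇒≤ t<m)))
          Lx≡2+i : L x ≡ suc (suc i)
          Lx≡2+i = proj₂ (L-onto (suc (suc i)) (s≤s z≤n) (NP.≤-trans 1+i<t (NP.<⇒≤ t<m)))
          upper : L (trunkAt c (suc i) j<t) ≤ suc (suc i)
          upper with trunkAt c (suc i) j<t F.≟ x
          ... | yes c≡x = NP.≤-reflexive (trans (cong L c≡x) Lx≡2+i)
          ... | no c≢x = contradiction (subst (L (trunkAt c (suc i) j<t) <_) Lx≡2+i (L-mono _ _ (trunkAt-below (suc i) j<t x avoids))) (NP.≤⇒≯ lower)
            where
              avoids : ∀ j′ .(j′<t : j′ < t) → j′ ≤ suc i → trunkAt c j′ j′<t ≢ x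
              avoids j′ j′<t j′≤1+i with j′ NP.≟ suc i
              ... | yes refl = c≢x
              ... | no j′≢1+i = λ cⱼ′≡x → NP.<⇒≢ (s≤s (s≤s j′≤i)) (trans (sym (labels-upto i i<t j′ j′<t j′≤i)) (trans (cong L cⱼ′≡x) Lx≡2+i))
                where j′≤i = NP.≤-pred (NP.≤∧≢⇒< j′≤1+i j′≢1+i)

    trunkAt-label : ∀ j (j<t : j < t) → L (trunkAt c j j<t) ≡ suc j
    trunkAt-label j j<t = labels-upto j j<t j j<t NP.≤-refl

    trunk-label≤t : ∀ {x} → InTrunk P c x → L x ≤ t
    trunk-label≤t x∈trunk with inTrunk⇒trunkAt c x∈trunk
    ... | i , i<t , refl = subst (_≤ t) (sym (trunkAt-label i i<t)) i<t

    z′-label : L z′ ≡ suc t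
    z′-label = NP.≤-antisym upper (lower t refl)
      where
        lower : ∀ u → u ≡ t → suc u ≤ L z′
        lower zero    _    = proj₁ (L-range z′)
        lower (suc u) 1+u≡t = subst (_< L z′) (trunkAt-label u u<t) (L-mono _ _ (trunk≺z′ (inTrunk-trunkAt c u u<t)))
          where u<t = NP.≤-reflexive 1+u≡t
        x : Fin n
        x = proj₁ (L-onto (suc t) (s≤s z≤n) t<m)
        Lx≡1+t : L x ≡ suc t
        Lx≡1+t = proj₂ (L-onto (suc t) (s≤s z≤n) t<m)
        upper : L z′ ≤ suc t
        upper = subst (L z′ ≤_) Lx≡1+t (≼⇒≤ (proj₂ z′-min x λ x∈trunk → NP.<-irrefl Lx≡1+t (s≤s (trunk-label≤t x∈trunk))))

    upper-label : ∀ {x} → Upper x → 2 + t ≤ L x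
    upper-label x∈Q = subst (_< L _) z′-label (L-mono _ _ (Upper⇒z′≺ x∈Q))

  module BranchFacts (B : Subset n) (branch : IsBranch P c z′ B) where
    private
      root : Fin n
      root = proj₁ (proj₁ branch)

      Reachable : Fin n → Set
      Reachable = Star (HasseAdj P Upper) root

      reachable : ∀ {b} → b ∈ B → Reachable b
      reachable {b} b∈B = proj₂ (proj₁ (proj₂ (proj₂ (proj₁ branch)) b) b∈B)

      reachable⇒∈ : ∀ {y} → Upper y → Reachable y → y ∈ B
      reachable⇒∈ {y} = proj₂ (proj₂ (proj₂ (proj₁ branch)) y)

    branch⇒Upper : ∀ {b} → b ∈ B → Upper b
    branch⇒Upper {b} b∈B = proj₁ (proj₁ (proj₂ (proj₂ (proj₁ branch)) b) b∈B)

    BranchLabel : (Fin n → ℕ) → ℕ → Set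
    BranchLabel L v = ∃ λ b → b ∈ B × L b ≡ v

    branchLabel? : ∀ L v → Dec (BranchLabel L v)
    branchLabel? L v = FP.any? λ b → (b ∈? B) ×-dec (L b NP.≟ v)

    branch-comparable : ∀ {x y} → x ∈ B → y ∈ B → x ≼ y ⊎ y ≼ x
    branch-comparable = proj₂ branch _ _

    private
      adjacent-in-branch : ∀ {b y} → b ∈ B → Upper y → HasseAdj P Upper b y → y ∈ B
      adjacent-in-branch b∈B y∈Q adj =
        reachable⇒∈ y∈Q (reachable b∈B ◅◅ (adj ◅ ε))

      cover-in : ∀ {x y} → Upper x → Upper y → x ⋖ₚ y → CoverIn P Upper x y
      cover-in x∈Q y∈Q (x≺y , tight) = x∈Q , y∈Q , x≺y , λ w _ → tight w

    branch-cover-above : ∀ {b y} → b ∈ B → b ⋖ₚ y → y ∈ B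
    branch-cover-above b∈B b⋖y = adjacent-in-branch b∈B y∈Q (inj₁ (cover-in (branch⇒Upper b∈B) y∈Q b⋖y))
      where y∈Q = z′≺⇒Upper (≺-trans (Upper⇒z′≺ (branch⇒Upper b∈B)) (proj₁ b⋖y))

    branch-cover-below : ∀ {b y} → b ∈ B → Upper y → y ⋖ₚ b → y ∈ B
    branch-cover-below b∈B y∈Q y⋖b = adjacent-in-branch b∈B y∈Q (inj₂ (cover-in y∈Q (branch⇒Upper b∈B) y⋖b))

    cover-below-branch : ∀ {b y} → b ∈ B → y ⋖ₚ b → y ≡ z′ ⊎ y ∈ B
    cover-below-branch {b} {y} b∈B y⋖b with y F.≟ z′ | inTrunk? c y
    ... | yes y≡z′ | _           = inj₁ y≡z′
    ... | no _     | yes y∈trunk = contradiction (trunk≺z′ y∈trunk , Upper⇒z′≺ (branch⇒Upper b∈B)) (proj₂ y⋖b z′)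
    ... | no y≢z′  | no y∉trunk  = inj₂ (branch-cover-below b∈B (y∉trunk , y≢z′) y⋖b)

    branch-cover-unique : ∀ {b c₁ c₂} → b ∈ B → b ⋖ₚ c₁ → b ⋖ₚ c₂ → c₁ ≡ c₂
    branch-cover-unique b∈B b⋖c₁ b⋖c₂ with branch-comparable (branch-cover-above b∈B b⋖c₁) (branch-cover-above b∈B b⋖c₂)
    ... | inj₁ c₁≼c₂ = [ id , (λ c₁≺c₂ → contradiction (proj₁ b⋖c₁ , c₁≺c₂) (proj₂ b⋖c₂ _)) ]′ (≼⇒≡⊎≺ c₁≼c₂)
    ... | inj₂ c₂≼c₁ = [ sym , (λ c₂≺c₁ → contradiction (proj₁ b⋖c₂ , c₂≺c₁) (proj₂ b⋖c₁ _)) ]′ (≼⇒≡⊎≺ c₂≼c₁)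

    branch-label-injective : ∀ {L} → StrictlyMonotone L → ∀ {x y} → x ∈ B → y ∈ B → L x ≡ L y → x ≡ y
    branch-label-injective mono x∈B y∈B Lx≡Ly with branch-comparable x∈B y∈B
    ... | inj₁ x≼y = [ id , (λ x≺y → contradiction Lx≡Ly (NP.<⇒≢ (mono _ _ x≺y))) ]′ (≼⇒≡⊎≺ x≼y)
    ... | inj₂ y≼x = [ sym , (λ y≺x → contradiction (sym Lx≡Ly) (NP.<⇒≢ (mono _ _ y≺x))) ]′ (≼⇒≡⊎≺ y≼x)

    private
      above-closed : ∀ N {b y} → L₀ y ≤ L₀ b + N → b ∈ B → b ≺ₚ y → y ∈ B
      above-closed N {b} {y} gap b∈B b≺y with cover-above b≺y
      ... | w , b⋖w , w≼y with ≼⇒≡⊎≺ w≼y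
      ...   | inj₁ refl = branch-cover-above b∈B b⋖w
      ...   | inj₂ w≺y with N
      ...     | zero  = contradiction (L₀-mono b y b≺y) (NP.≤⇒≯ (subst (L₀ y ≤_) (NP.+-identityʳ _) gap))
      ...     | suc N′ = above-closed N′ (NP.≤-trans gap (subst (_≤ L₀ w + N′) (sym (NP.+-suc (L₀ b) N′)) (NP.+-monoˡ-≤ N′ (L₀-mono b w (proj₁ b⋖w)))))
                                  (branch-cover-above b∈B b⋖w) w≺y

    branch-upward-closed : ∀ {b y} → b ∈ B → b ≺ₚ y → y ∈ B
    branch-upward-closed {b} {y} = above-closed (L₀ y) (NP.m≤n+m (L₀ y) (L₀ b))

    private
      below-closed : ∀ N {b y} → L₀ b ≤ L₀ y + N → b ∈ B → Upper y → y ≺ₚ b → y ∈ B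
      below-closed N {b} {y} gap b∈B y∈Q y≺b with cover-below y≺b
      ... | w , y≼w , w⋖b with ≼⇒≡⊎≺ y≼w
      ...   | inj₁ refl = branch-cover-below b∈B y∈Q w⋖b
      ...   | inj₂ y≺w with N
      ...     | zero  = contradiction (L₀-mono y b y≺b) (NP.≤⇒≯ (subst (L₀ b ≤_) (NP.+-identityʳ _) gap))
      ...     | suc N′ = below-closed N′ (NP.≤-pred (NP.<-≤-trans (L₀-mono w b (proj₁ w⋖b)) (subst (L₀ b ≤_) (NP.+-suc (L₀ y) N′) gap)))
                           (branch-cover-below b∈B w∈Q w⋖b) y∈Q y≺w
        where w∈Q = z′≺⇒Upper (≺-≼-trans (Upper⇒z′≺ y∈Q) y≼w)

    branch-downward-closed : ∀ {b y} → b ∈ B → Upper y → y ≺ₚ b → y ∈ B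
    branch-downward-closed {b} {y} = below-closed (L₀ b) (NP.m≤n+m (L₀ b) (L₀ y))

module BranchDynamics {n : ℕ} (P : FinPoset n) (z : Fin n) (z-min : IsMinimum P z)
                      {t : ℕ} (c : Fin t → Fin n) (trunk : IsTrunkChain P z t c)
                      (z′ : Fin n) (z′-min : IsMinimumOfComplement P c z′)
                      (B : Subset n) (branch : IsBranch P c z′ B)
                      {m : ℕ} (1≤m : 1 ≤ m) (2+t≤m : 2 + t ≤ m)
                      {L : Fin n → ℕ} (packed : IsPackedLabeling P m L) where
  open Order P
  open Promotion P
  open Stages m L
  open PackedLabeling P packed using (L-range; L-mono)
  open TrunkFacts P z z-min c trunk z′ z′-min L L-mono
  open BranchFacts B branch
  open TrunkLabels (NP.<-trans (NP.n<1+n t) 2+t≤m) packed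
  open Covers L L-mono

  ∂L : Fin n → ℕ
  ∂L = kPromotion P m L

  private
    final = m ∸ 1
    t<final : t < final
    t<final = NP.∸-monoˡ-≤ 1 2+t≤m
    1+final≡m : suc final ≡ m
    1+final≡m = NP.m+[n∸m]≡n 1≤m
    invariantAt : ∀ j → j ≤ final → StageInvariant j
    invariantAt = invariant packed 1≤m

  -- Since ∂L is packed, the trunk-label lemma applied to ∂L pins down the final value at z′.
  z′-final : stage final z′ ≡ just (2 + t)
  z′-final = finalize⁻¹ (stage final z′) (trans (sym (kPromotion≡finalize z′)) (TrunkLabels.z′-label (NP.<-trans (NP.n<1+n t) 2+t≤m) (kPromotion-packed packed 1≤m)))
    where
      finalize⁻¹ : ∀ v → finalize v ≡ suc t → v ≡ just (2 + t)
      finalize⁻¹ nothing        m≡1+t  = contradiction (sym m≡1+t) (NP.<⇒≢ 2+t≤m)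
      finalize⁻¹ (just (suc a)) a≡1+t = cong (just ∘ suc) a≡1+t

  settled-final : ∀ {j x a} → j ≤ final → stage j x ≡ just a → a ≤ suc j → stage final x ≡ just a
  settled-final {j} {x} {a} j≤final sx a≤1+j = subst (λ w → stage w x ≡ just a) (NP.m∸n+n≡m j≤final) (stage-settled sx a≤1+j (final ∸ j))

  z′-vacated : stage t z′ ≡ nothing
  z′-vacated with stage t z′ in sz′
  ... | nothing = refl
  ... | just a  = contradiction (just-injective (trans (sym (settled-final (NP.<⇒≤ t<final) sz′ a≤1+t)) z′-final)) (NP.<⇒≢ (s≤s a≤1+t))
    where
      a≤1+t : a ≤ suc t
      a≤1+t = [ NP.≤-reflexive ∘ (λ a≡Lz′ → trans a≡Lz′ z′-label) , id ]′ (StageInvariant.originalOrSettled (invariantAt t (NP.<⇒≤ t<final)) sz′)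

  z′-refilled : ∀ d → stage (d + suc t) z′ ≡ just (2 + t)
  z′-refilled = stage-settled refilled NP.≤-refl
    where
      refilled : stage (suc t) z′ ≡ just (2 + t)
      refilled with labelAbove? (2 + t) (stage t) z′
      ... | yes above = kStep-fill (stage t) z′ z′-vacated above
      ... | no ¬above with stage-hole-later (kStep-empty (stage t) z′ z′-vacated ¬above) (final ∸ suc t)
      ...   | inj₁ hole = just≢nothing (subst (λ w → stage w z′ ≡ just (2 + t)) (sym (NP.m∸n+n≡m t<final)) z′-final) hole
      ...   | inj₂ (a , sz′ , 3+t≤a) = contradiction (just-injective (trans (sym (subst (λ w → stage w z′ ≡ just a) (NP.m∸n+n≡m t<final) sz′)) z′-final)) (NP.<⇒≢ 3+t≤a ∘ sym)

  branch-at-t : ∀ {b} → b ∈ B → stage t b ≡ just (L b)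
  branch-at-t b∈B = StageInvariant.unprocessed (invariantAt t (NP.<⇒≤ t<final)) _ (upper-label (branch⇒Upper b∈B))

  z′⋖-bottom : ∀ {b} → Upper b → L b ≡ 2 + t → z′ ⋖ₚ b
  z′⋖-bottom {b} b∈Q Lb≡2+t = Upper⇒z′≺ b∈Q , λ w (z′≺w , w≺b) →
    NP.<-irrefl refl (NP.<-≤-trans (subst (L w <_) Lb≡2+t (L-mono w b w≺b)) (upper-label (z′≺⇒Upper z′≺w)))

  lower-cover-in-branch : BranchLabel L (2 + t) → ∀ {b} → b ∈ B → 2 + t < L b → ∃ λ w → w ∈ B × w ⋖ₚ b
  lower-cover-in-branch (b₀ , b₀∈B , Lb₀≡2+t) {b} b∈B 2+t<Lb with branch-comparable b₀∈B b∈B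
  ... | inj₂ b≼b₀ = contradiction (subst (L b ≤_) Lb₀≡2+t (≼⇒≤ b≼b₀)) (NP.<⇒≱ 2+t<Lb)
  ... | inj₁ b₀≼b with ≼⇒≡⊎≺ b₀≼b
  ...   | inj₁ refl = contradiction Lb₀≡2+t (NP.<⇒≢ 2+t<Lb ∘ sym)
  ...   | inj₂ b₀≺b with cover-below b₀≺b
  ...     | w , b₀≼w , w⋖b = w , branch-cover-below b∈B (z′≺⇒Upper (≺-≼-trans (Upper⇒z′≺ (branch⇒Upper b₀∈B)) b₀≼w)) w⋖b , w⋖b

  -- When the bottom of the branch carries 2+t, the hole vacated at z′ climbs the branch; Sliding j b says where it is at stage j.
  record Sliding (j : ℕ) (b : Fin n) : Set where
    field
      unreached : suc j < L b → stage j b ≡ just (L b)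
      shifted   : L b ≤ suc j → ∀ {c} → b ⋖ₚ c → L c ≤ suc j → stage j b ≡ just (L c)
      vacant    : L b ≤ suc j → (∀ {c} → b ⋖ₚ c → suc j < L c) → stage j b ≡ nothing

  sliding-start : ∀ {b} → b ∈ B → Sliding t b
  sliding-start b∈B = record
    { unreached = λ _ → branch-at-t b∈B
    ; shifted   = λ Lb≤1+t → contradiction Lb≤1+t (NP.<⇒≱ (upper-label (branch⇒Upper b∈B)))
    ; vacant    = λ Lb≤1+t → contradiction Lb≤1+t (NP.<⇒≱ (upper-label (branch⇒Upper b∈B)))
    }

  module SlidingStep (bottom : BranchLabel L (2 + t)) {j : ℕ} (t≤j : t ≤ j) (S : ∀ {b} → b ∈ B → Sliding j b) {b : Fin n} (b∈B : b ∈ B) where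
    open Sliding

    unreached-step : 2 + j < L b → Sliding (suc j) b
    unreached-step 2+j<Lb = record
      { unreached = λ _ → kStep-keep (stage j) b (unreached (S b∈B) (NP.<-trans (NP.n<1+n _) 2+j<Lb)) (NP.<⇒≢ 2+j<Lb ∘ sym)
      ; shifted   = λ Lb≤2+j → contradiction Lb≤2+j (NP.<⇒≱ 2+j<Lb)
      ; vacant    = λ Lb≤2+j → contradiction Lb≤2+j (NP.<⇒≱ 2+j<Lb)
      }

    -- The hole below b is z′ at the first step, and later the branch element just below b, emptied one step earlier.
    vacating-step : L b ≡ 2 + j → Sliding (suc j) b
    vacating-step Lb≡2+j = record
      { unreached = λ 2+j<Lb → contradiction 2+j<Lb (NP.<-irrefl (sym Lb≡2+j))
      ; shifted   = λ _ b⋖c Lc≤2+j → contradiction Lc≤2+j (NP.<⇒≱ (subst (_< L _) Lb≡2+j (L-mono _ _ (proj₁ b⋖c))))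
      ; vacant    = λ _ _ → kStep-slide (stage j) b sb hole-below-b
      }
      where
        sb : stage j b ≡ just (2 + j)
        sb = subst (λ v → stage j b ≡ just v) Lb≡2+j (unreached (S b∈B) (subst (suc j <_) (sym Lb≡2+j) NP.≤-refl))
        hole-below-b : HoleBelow (stage j) b
        hole-below-b with j NP.≟ t
        ... | yes refl = z′ , z′⋖-bottom (branch⇒Upper b∈B) Lb≡2+j , z′-vacated
        ... | no j≢t with lower-cover-in-branch bottom b∈B (subst (2 + t <_) (sym Lb≡2+j) (s≤s (s≤s (NP.≤∧≢⇒< t≤j (j≢t ∘ sym)))))
        ...   | w , w∈B , w⋖b = w , w⋖b , vacant (S w∈B) (NP.≤-pred (subst (L w <_) Lb≡2+j (L-mono w b (proj₁ w⋖b))))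
                  (λ w⋖c → subst (λ u → suc j < L u) (branch-cover-unique w∈B w⋖b w⋖c) (subst (suc j <_) (sym Lb≡2+j) NP.≤-refl))

    settled-step : L b < 2 + j → Sliding (suc j) b
    settled-step Lb<2+j with FP.any? (λ c → (b ⋖? c) ×-dec (L c NP.≤? suc j))
    ... | yes (c , b⋖c , Lc≤1+j) = record
      { unreached = λ 2+j<Lb → contradiction Lb<2+j (NP.<⇒≯ 2+j<Lb)
      ; shifted   = λ _ b⋖c′ _ → subst (λ u → kStep P (2 + j) (stage j) b ≡ just (L u)) (branch-cover-unique b∈B b⋖c b⋖c′)
                      (kStep-keep (stage j) b (shifted (S b∈B) (NP.≤-pred Lb<2+j) b⋖c Lc≤1+j) (NP.<⇒≢ (s≤s Lc≤1+j)))
      ; vacant    = λ _ all-above → contradiction (all-above b⋖c) (NP.≤⇒≯ (NP.m≤n⇒m≤1+n Lc≤1+j))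
      }
    ... | no none with labelAbove? (2 + j) (stage j) b
    ...   | yes (y , b⋖y , sy) = record
      { unreached = λ 2+j<Lb → contradiction Lb<2+j (NP.<⇒≯ 2+j<Lb)
      ; shifted   = λ _ b⋖c _ → subst (λ u → kStep P (2 + j) (stage j) b ≡ just (L u)) (branch-cover-unique b∈B b⋖y b⋖c)
                      (subst (λ v → kStep P (2 + j) (stage j) b ≡ just v) (sym Ly≡2+j) (kStep-fill (stage j) b vacant-b (y , b⋖y , sy)))
      ; vacant    = λ _ all-above → contradiction (all-above b⋖y) (NP.<-irrefl (sym Ly≡2+j))
      }
      where
        above-1+j : ∀ {c} → b ⋖ₚ c → suc j < L c
        above-1+j {c} b⋖c = NP.≰⇒> λ Lc≤1+j → none (c , b⋖c , Lc≤1+j)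
        vacant-b : stage j b ≡ nothing
        vacant-b = vacant (S b∈B) (NP.≤-pred Lb<2+j) above-1+j
        Ly≡2+j : L y ≡ 2 + j
        Ly≡2+j = just-injective (trans (sym (unreached (S (branch-cover-above b∈B b⋖y)) (above-1+j b⋖y))) sy)
    ...   | no ¬above = record
      { unreached = λ 2+j<Lb → contradiction Lb<2+j (NP.<⇒≯ 2+j<Lb)
      ; shifted   = λ _ {c} b⋖c Lc≤2+j → contradiction (c , b⋖c , subst (λ v → stage j c ≡ just v) (NP.≤-antisym Lc≤2+j (above-1+j b⋖c))
                      (unreached (S (branch-cover-above b∈B b⋖c)) (above-1+j b⋖c))) ¬above
      ; vacant    = λ _ _ → kStep-empty (stage j) b (vacant (S b∈B) (NP.≤-pred Lb<2+j) above-1+j) ¬above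
      }
      where
        above-1+j : ∀ {c} → b ⋖ₚ c → suc j < L c
        above-1+j {c} b⋖c = NP.≰⇒> λ Lc≤1+j → none (c , b⋖c , Lc≤1+j)

    sliding-step : Sliding (suc j) b
    sliding-step with NP.<-cmp (L b) (2 + j)
    ... | tri< Lb<2+j _ _      = settled-step Lb<2+j
    ... | tri≈ _ Lb≡2+j _      = vacating-step Lb≡2+j
    ... | tri> _ _ 2+j<Lb      = unreached-step 2+j<Lb

  private
    t≤final : t ≤ final
    t≤final = NP.<⇒≤ t<final
    L≤1+final : ∀ x → L x ≤ suc final
    L≤1+final x = subst (L x ≤_) (sym 1+final≡m) (proj₂ (L-range x))

    sliding : BranchLabel L (2 + t) → ∀ d {b} → b ∈ B → Sliding (d + t) b
    sliding bottom zero    = sliding-start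
    sliding bottom (suc d) b∈B = SlidingStep.sliding-step bottom (NP.m≤n+m t d) (sliding bottom d) b∈B

    sliding-final : BranchLabel L (2 + t) → ∀ {b} → b ∈ B → Sliding final b
    sliding-final bottom {b} b∈B = subst (λ j → Sliding j b) (NP.m∸n+n≡m t≤final) (sliding bottom (final ∸ t) b∈B)

    fixed : ¬ BranchLabel L (2 + t) → ∀ d {b} → b ∈ B → stage (d + t) b ≡ just (L b)
    fixed ¬bottom zero    b∈B = branch-at-t b∈B
    fixed ¬bottom (suc d) {b} b∈B with L b NP.≟ 2 + (d + t)
    ... | no Lb≢i  = kStep-keep (stage (d + t)) b (fixed ¬bottom d b∈B) Lb≢i
    ... | yes Lb≡i = subst (λ v → kStep P (2 + (d + t)) (stage (d + t)) b ≡ just v) (sym Lb≡i)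
                       (kStep-stay (stage (d + t)) b (subst (λ v → stage (d + t) b ≡ just v) Lb≡i (fixed ¬bottom d b∈B)) no-hole)
      where
        z′-occupied : ∀ d′ {b′} → b′ ∈ B → L b′ ≡ 2 + (d′ + t) → stage (d′ + t) z′ ≢ nothing
        z′-occupied zero    b′∈B Lb′≡2+t = contradiction (_ , b′∈B , Lb′≡2+t) ¬bottom
        z′-occupied (suc d′) _ _ = just≢nothing (subst (λ j → stage j z′ ≡ just (2 + t)) (NP.+-suc d′ t) (z′-refilled d′))
        no-hole : ¬ HoleBelow (stage (d + t)) b
        no-hole (w , w⋖b , sw) with cover-below-branch b∈B w⋖b
        ... | inj₂ w∈B = just≢nothing (fixed ¬bottom d w∈B) sw
        ... | inj₁ refl = z′-occupied d b∈B Lb≡i sw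

  ∂L-branch-cover : BranchLabel L (2 + t) → ∀ {b c} → b ∈ B → b ⋖ₚ c → ∂L b ≡ L c ∸ 1
  ∂L-branch-cover bottom {b} {c} b∈B b⋖c =
    trans (kPromotion≡finalize b) (cong finalize (Sliding.shifted (sliding-final bottom b∈B) (L≤1+final b) b⋖c (L≤1+final c)))

  ∂L-branch-top : BranchLabel L (2 + t) → ∀ {b} → b ∈ B → (∀ c → ¬ b ⋖ₚ c) → ∂L b ≡ m
  ∂L-branch-top bottom {b} b∈B maximal =
    trans (kPromotion≡finalize b) (cong finalize (Sliding.vacant (sliding-final bottom b∈B) (L≤1+final b) λ {c} b⋖c → contradiction b⋖c (maximal c)))

  ∂L-branch-fixed : ¬ BranchLabel L (2 + t) → ∀ {b} → b ∈ B → ∂L b ≡ L b ∸ 1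
  ∂L-branch-fixed ¬bottom {b} b∈B =
    trans (kPromotion≡finalize b) (cong finalize (subst (λ j → stage j b ≡ just (L b)) (NP.m∸n+n≡m t≤final) (fixed ¬bottom (final ∸ t) b∈B)))

  private
    top-above : ∀ N {b} → m ≤ L b + N → b ∈ B → ∃ λ b′ → b′ ∈ B × (∀ c → ¬ b′ ⋖ₚ c)
    top-above N {b} gap b∈B with FP.any? (b ⋖?_)
    ... | no maximal = b , b∈B , λ c b⋖c → maximal (c , b⋖c)
    top-above zero    {b} gap b∈B | yes (c , b⋖c) =
      contradiction (NP.≤-trans (proj₂ (L-range c)) (subst (m ≤_) (NP.+-identityʳ _) gap)) (NP.<⇒≱ (L-mono b c (proj₁ b⋖c)))
    top-above (suc N) {b} gap b∈B | yes (c , b⋖c) =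
      top-above N (NP.≤-trans gap (subst (_≤ L c + N) (sym (NP.+-suc (L b) N)) (NP.+-monoˡ-≤ N (L-mono b c (proj₁ b⋖c)))))
                (branch-cover-above b∈B b⋖c)

    branch-top : ∀ {b} → b ∈ B → ∃ λ b′ → b′ ∈ B × (∀ c → ¬ b′ ⋖ₚ c)
    branch-top {b} = top-above m (NP.m≤n+m m (L b))

    ∸1-injective : ∀ {a v} → 1 ≤ a → a ∸ 1 ≡ v → a ≡ suc v
    ∸1-injective {suc a} _ a≡v = cong suc a≡v

  branchLabel-rotate : ∀ {v} → 2 + t ≤ v → v < m → BranchLabel ∂L v ⇔ BranchLabel L (suc v)
  branchLabel-rotate {v} 2+t≤v v<m = mk⇔ forward backward
    where
      forward : BranchLabel ∂L v → BranchLabel L (suc v)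
      forward (b , b∈B , ∂Lb≡v) with branchLabel? L (2 + t)
      ... | no ¬bottom = b , b∈B , ∸1-injective (proj₁ (L-range b)) (trans (sym (∂L-branch-fixed ¬bottom b∈B)) ∂Lb≡v)
      ... | yes bottom with FP.any? (b ⋖?_)
      ...   | yes (c , b⋖c) = c , branch-cover-above b∈B b⋖c , ∸1-injective (proj₁ (L-range c)) (trans (sym (∂L-branch-cover bottom b∈B b⋖c)) ∂Lb≡v)
      ...   | no maximal    = contradiction (trans (sym ∂Lb≡v) (∂L-branch-top bottom b∈B λ c b⋖c → maximal (c , b⋖c))) (NP.<⇒≢ v<m)
      backward : BranchLabel L (suc v) → BranchLabel ∂L v
      backward (b , b∈B , Lb≡1+v) with branchLabel? L (2 + t)
      ... | no ¬bottom = b , b∈B , trans (∂L-branch-fixed ¬bottom b∈B) (cong (_∸ 1) Lb≡1+v)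
      ... | yes bottom with lower-cover-in-branch bottom b∈B (subst (2 + t <_) (sym Lb≡1+v) (s≤s 2+t≤v))
      ...   | w , w∈B , w⋖b = w , w∈B , trans (∂L-branch-cover bottom w∈B w⋖b) (cong (_∸ 1) Lb≡1+v)

  branchLabel-wrap : BranchLabel ∂L m ⇔ BranchLabel L (2 + t)
  branchLabel-wrap = mk⇔ forward backward
    where
      forward : BranchLabel ∂L m → BranchLabel L (2 + t)
      forward (b , b∈B , ∂Lb≡m) with branchLabel? L (2 + t)
      ... | yes bottom = bottom
      ... | no ¬bottom = contradiction (trans (sym ∂Lb≡m) (∂L-branch-fixed ¬bottom b∈B))
                           (NP.<⇒≢ (NP.<-≤-trans (NP.∸-monoʳ-< {L b} {1} {0} (s≤s z≤n) (proj₁ (L-range b))) (proj₂ (L-range b))) ∘ sym)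
      backward : BranchLabel L (2 + t) → BranchLabel ∂L m
      backward bottom@(b , b∈B , _) with branch-top b∈B
      ... | b′ , b′∈B , maximal = b′ , b′∈B , ∂L-branch-top bottom b′∈B maximal

module Corollary {n : ℕ} (P : FinPoset n) (z : Fin n) (z-min : IsMinimum P z)
                 {t : ℕ} (c : Fin t → Fin n) (trunk : IsTrunkChain P z t c)
                 (z′ : Fin n) (z′-min : IsMinimumOfComplement P c z′)
                 (B : Subset n) (branch : IsBranch P c z′ B)
                 {m : ℕ} (1≤m : 1 ≤ m) {k : ℕ} (∣B∣≡k : ∣ B ∣ ≡ k) (1≤k : 1 ≤ k) (k+t+2≤m : k + t + 2 ≤ m)
                 {L₀ : Fin n → ℕ} (packed₀ : IsPackedLabeling P m L₀) where
  open Order P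
  open Promotion P
  open PackedLabeling P packed₀ renaming (L-range to L₀-range; L-onto to L₀-onto; L-mono to L₀-mono)
  open TrunkFacts P z z-min c trunk z′ z′-min L₀ L₀-mono
  open BranchFacts B branch
  open TrunkIndexing P z using (inTrunk?)

  ∂ : (Fin n → ℕ) → Fin n → ℕ
  ∂ = kPromotion P m

  q′ : ℕ
  q′ = m ∸ t ∸ 2

  q : ℕ
  q = suc q′

  private
    2+t≤m : 2 + t ≤ m
    2+t≤m = NP.≤-trans (NP.≤-reflexive (NP.+-comm 2 t)) (NP.≤-trans (NP.m≤n+m (t + 2) k) (subst (_≤ m) (NP.+-assoc k t 2) k+t+2≤m))

    window : ∀ m t → 2 + t ≤ m → m ∸ t ∸ 1 ≡ suc (m ∸ t ∸ 2) × 2 + t + (m ∸ t ∸ 2) ≡ m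
    window (suc (suc m)) zero    _         = refl , refl
    window (suc m)       (suc t) (s≤s 2+t≤m) = let (eq₁ , eq₂) = window m t 2+t≤m in eq₁ , cong suc eq₂

  q≡ : m ∸ t ∸ 1 ≡ q
  q≡ = proj₁ (window m t 2+t≤m)

  2+t+q′≡m : 2 + t + q′ ≡ m
  2+t+q′≡m = proj₂ (window m t 2+t≤m)

  2+t+k≤m : 2 + t + k ≤ m
  2+t+k≤m = subst (_≤ m) (trans (NP.+-comm (k + t) 2) (cong (2 +_) (NP.+-comm k t))) k+t+2≤m

  k<q : k < q
  k<q = s≤s (NP.+-cancelˡ-≤ (2 + t) k q′ (subst (2 + t + k ≤_) (sym 2+t+q′≡m) 2+t+k≤m))

  occupied : (Fin n → ℕ) → ℕ → ℕ
  occupied L o = indicator (branchLabel? L (2 + t + o))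

  occupied-rotate : ∀ {L} → IsPackedLabeling P m L → ∀ o → o < q → occupied (∂ L) o ≡ occupied L (suc o % q)
  occupied-rotate {L} packed o o<q with suc o NP.<? q
  ... | yes 1+o<q = begin
    indicator (branchLabel? (∂ L) (2 + t + o))      ≡⟨ indicator-cong (branchLabel-rotate (NP.m≤m+n (2 + t) o) 2+t+o<m) _ _ ⟩
    indicator (branchLabel? L (suc (2 + t + o)))    ≡⟨ cong (indicator ∘ branchLabel? L) (trans (sym (NP.+-suc (2 + t) o)) (cong (2 + t +_) (sym (m<n⇒m%n≡m 1+o<q)))) ⟩
    occupied L (suc o % q)                          ∎
    where
      open ≡-Reasoning
      open BranchDynamics P z z-min c trunk z′ z′-min B branch 1≤m 2+t≤m packed
      2+t+o<m : 2 + t + o < m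
      2+t+o<m = subst (2 + t + o <_) 2+t+q′≡m (subst (_≤ 2 + t + q′) (NP.+-suc (2 + t) o) (NP.+-monoʳ-≤ (2 + t) (NP.≤-pred 1+o<q)))
  ... | no  1+o≮q = begin
    indicator (branchLabel? (∂ L) (2 + t + o))      ≡⟨ cong (indicator ∘ branchLabel? (∂ L)) 2+t+o≡m ⟩
    indicator (branchLabel? (∂ L) m)                ≡⟨ indicator-cong branchLabel-wrap _ _ ⟩
    indicator (branchLabel? L (2 + t))              ≡⟨ cong (indicator ∘ branchLabel? L) (trans (cong (2 + t +_) (trans (cong (_% q) 1+o≡q) (n%n≡0 q))) (NP.+-identityʳ (2 + t))) ⟨
    occupied L (suc o % q)                          ∎
    where
      open ≡-Reasoning
      open BranchDynamics P z z-min c trunk z′ z′-min B branch 1≤m 2+t≤m packed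
      1+o≡q : suc o ≡ q
      1+o≡q = NP.≤-antisym o<q (NP.≮⇒≥ 1+o≮q)
      2+t+o≡m : 2 + t + o ≡ m
      2+t+o≡m = trans (cong (2 + t +_) (NP.suc-injective 1+o≡q)) 2+t+q′≡m

  private
    [a%q+d]%q≡[a+d]%q : ∀ a d → ((a % q) + d) % q ≡ (a + d) % q
    [a%q+d]%q≡[a+d]%q a d = begin
      ((a % q) + d) % q                ≡⟨ %-distribˡ-+ (a % q) d q ⟩
      ((a % q % q) + (d % q)) % q      ≡⟨ cong (λ w → (w + d % q) % q) (m%n%n≡m%n a q) ⟩
      ((a % q) + (d % q)) % q          ≡⟨ %-distribˡ-+ a d q ⟨
      (a + d) % q                      ∎
      where open ≡-Reasoning

  occupied-iterate : ∀ {L} → IsPackedLabeling P m L → ∀ d o → o < q → occupied (iter d ∂ L) o ≡ occupied L ((o + d) % q)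
  occupied-iterate {L} packed zero o o<q = cong (occupied L) (sym (trans (cong (_% q) (NP.+-identityʳ o)) (m<n⇒m%n≡m o<q)))
  occupied-iterate {L} packed (suc d) o o<q = begin
    occupied (∂ (iter d ∂ L)) o         ≡⟨ occupied-rotate (iter-kPromotion-packed 1≤m packed d) o o<q ⟩
    occupied (iter d ∂ L) (suc o % q)   ≡⟨ occupied-iterate packed d (suc o % q) (m%n<n (suc o) q) ⟩
    occupied L ((suc o % q + d) % q)    ≡⟨ cong (occupied L) (trans ([a%q+d]%q≡[a+d]%q (suc o) d) (cong (_% q) (sym (NP.+-suc o d)))) ⟩
    occupied L ((o + suc d) % q)        ∎
    where open ≡-Reasoning

  occupancy : ∀ {L} → IsPackedLabeling P m L → sumBelow q (occupied L) ≡ k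
  occupancy {L} packed = begin
    sumBelow q (occupied L)                                                  ≡⟨ sumBelow-cong q (λ o _ → indicator-cong offset⇔label _ _) ⟨
    count (λ o → FP.any? λ x → (x ∈? B) ×-dec (offset x NP.≟ o)) q          ≡⟨ ∑indicator-image n (_∈? B) offset offset-injective q ⟨
    ∑[ x < n ] indicator ((x ∈? B) ×-dec (offset x NP.<? q))                ≡⟨ sum-cong-≗ {n} (λ x → indicator-cong (mk⇔ proj₁ (λ x∈B → x∈B , offset<q x∈B)) _ _) ⟩
    ∑[ x < n ] indicator (x ∈? B)                                            ≡⟨ ∣p∣≡∑indicator B ⟨
    ∣ B ∣                                                                    ≡⟨ ∣B∣≡k ⟩
    k                                                                        ∎
    where
      open ≡-Reasoning
      open TrunkLabels (NP.<-trans (NP.n<1+n t) 2+t≤m) packed using (upper-label)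
      open PackedLabeling P packed using (L-range; L-mono)
      offset : Fin n → ℕ
      offset x = L x ∸ (2 + t)
      offset+2+t : ∀ {x} → x ∈ B → offset x + (2 + t) ≡ L x
      offset+2+t x∈B = NP.m∸n+n≡m (upper-label (branch⇒Upper x∈B))
      offset-injective : ∀ x y → x ∈ B → y ∈ B → offset x ≡ offset y → x ≡ y
      offset-injective x y x∈B y∈B eq = branch-label-injective L-mono x∈B y∈B
        (trans (sym (offset+2+t x∈B)) (trans (cong (_+ (2 + t)) eq) (offset+2+t y∈B)))
      offset<q : ∀ {x} → x ∈ B → offset x < q
      offset<q {x} x∈B = s≤s (subst (offset x ≤_) (trans (cong (_∸ (2 + t)) (sym 2+t+q′≡m)) (NP.m+n∸m≡n (2 + t) q′))
                                   (NP.∸-monoˡ-≤ (2 + t) (proj₂ (L-range x))))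
      offset⇔label : ∀ {o} → (∃ λ x → x ∈ B × offset x ≡ o) ⇔ BranchLabel L (2 + t + o)
      offset⇔label {o} = mk⇔ (λ (x , x∈B , eq) → x , x∈B , trans (sym (offset+2+t x∈B)) (trans (cong (_+ (2 + t)) eq) (NP.+-comm o (2 + t))))
                             (λ (x , x∈B , eq) → x , x∈B , trans (cong (_∸ (2 + t)) eq) (NP.m+n∸m≡n (2 + t) o))

  occupied-cong : ∀ {L L′} → (∀ x → L x ≡ L′ x) → ∀ o → occupied L o ≡ occupied L′ o
  occupied-cong L≗L′ o = indicator-cong (mk⇔ (relabel L≗L′) (relabel (sym ∘ L≗L′))) _ _
    where relabel : ∀ {L L′ v} → (∀ x → L x ≡ L′ x) → BranchLabel L v → BranchLabel L′ v
          relabel L≗L′ (b , b∈B , Lb≡v) = b , b∈B , trans (sym (L≗L′ b)) Lb≡v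

  moment-step : ∀ {L} → IsPackedLabeling P m L → moment q (occupied (∂ L)) + k ≡ moment q (occupied L) + q * occupied L 0
  moment-step {L} packed =
    subst (λ w → moment q (occupied (∂ L)) + w ≡ moment q (occupied L) + q * occupied L 0) (occupancy packed)
      (moment-rotate q′ (occupied L) (occupied (∂ L)) (occupied-rotate packed))

  moment-iterate : ∀ {L} → IsPackedLabeling P m L → ∀ d →
    moment q (occupied (iter d ∂ L)) + d * k ≡ moment q (occupied L) + q * sumBelow d (λ j → occupied (iter j ∂ L) 0)
  moment-iterate {L} packed zero = trans (NP.+-identityʳ Φ₀) (sym (trans (cong (Φ₀ +_) (NP.*-zeroʳ q)) (NP.+-identityʳ Φ₀)))
    where Φ₀ = moment q (occupied L)
  moment-iterate {L} packed (suc d) = begin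
    Φ (suc d) + (k + d * k)          ≡⟨ NP.+-assoc (Φ (suc d)) k (d * k) ⟨
    (Φ (suc d) + k) + d * k          ≡⟨ cong (_+ d * k) (moment-step (iter-kPromotion-packed 1≤m packed d)) ⟩
    (Φ d + q * hit d) + d * k        ≡⟨ +-swapʳ (Φ d) (q * hit d) (d * k) ⟩
    (Φ d + d * k) + q * hit d        ≡⟨ cong (_+ q * hit d) (moment-iterate packed d) ⟩
    (Φ 0 + q * C) + q * hit d        ≡⟨ NP.+-assoc (Φ 0) (q * C) (q * hit d) ⟩
    Φ 0 + (q * C + q * hit d)        ≡⟨ cong (Φ 0 +_) (NP.*-distribˡ-+ q C (hit d)) ⟨
    Φ 0 + q * (C + hit d)            ∎
    where
      open ≡-Reasoning
      Φ : ℕ → ℕ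
      Φ j = moment q (occupied (iter j ∂ L))
      hit : ℕ → ℕ
      hit j = occupied (iter j ∂ L) 0
      C = sumBelow d hit
      +-swapʳ : ∀ a b c → (a + b) + c ≡ (a + c) + b
      +-swapʳ a b c = trans (NP.+-assoc a b c) (trans (cong (a +_) (NP.+-comm b c)) (sym (NP.+-assoc a c b)))

  orbit-divisible : gcd k (m ∸ t ∸ 1) ≡ 1 → ∀ {L} → IsPackedLabeling P m L → ∀ d → (∀ x → iter d ∂ L x ≡ L x) → m ∸ t ∸ 1 ∣ d
  orbit-divisible gcd≡1 {L} packed d periodic = subst (_∣ d) (sym q≡) (coprime-divisor q⊥k (divides C k*d≡C*q))
    where
      C = sumBelow d (λ j → occupied (iter j ∂ L) 0)
      same-moment : moment q (occupied (iter d ∂ L)) ≡ moment q (occupied L)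
      same-moment = sumBelow-cong q λ o _ → cong (o *_) (occupied-cong periodic o)
      k*d≡C*q : k * d ≡ C * q
      k*d≡C*q = trans (NP.*-comm k d) (trans (NP.+-cancelˡ-≡ (moment q (occupied L)) (d * k) (q * C) (trans (cong (_+ d * k) (sym same-moment)) (moment-iterate packed d))) (NP.*-comm q C))
      q⊥k : Coprime q k
      q⊥k = gcd≡1⇒coprime {q} {k} (trans (gcd-comm q k) (subst (λ w → gcd k w ≡ 1) q≡ gcd≡1))

  -- Keep the labels of the trunk and of z′, give the branch the labels 2+t, …, 1+t+k in order, and move the
  -- labels of the other upper elements, in order, to the top of [1, m].
  module Squeezed where
    open TrunkLabels (NP.<-trans (NP.n<1+n t) 2+t≤m) packed₀ using (upper-label; trunk-label≤t; z′-label)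

    Other : Fin n → Set
    Other x = Upper x × x ∉ B

    OtherLabel : ℕ → Set
    OtherLabel v = ∃ λ x → Other x × L₀ x ≡ v

    otherLabel? : ∀ v → Dec (OtherLabel v)
    otherLabel? v = FP.any? λ x → (upper? x ×-dec ¬? (x ∈? B)) ×-dec (L₀ x NP.≟ v)

    rankB : ℕ → ℕ
    rankB = count (branchLabel? L₀)

    rankO : ℕ → ℕ
    rankO = count otherLabel?

    #other : ℕ
    #other = rankO (suc m)

    base : ℕ
    base = suc m ∸ #other

    private
      2+t+q≡1+m : 2 + t + q ≡ suc m
      2+t+q≡1+m = trans (NP.+-suc (2 + t) q′) (cong suc 2+t+q′≡m)

      1+m∸[2+t]≡q : suc m ∸ (2 + t) ≡ q
      1+m∸[2+t]≡q = trans (cong (_∸ (2 + t)) (sym 2+t+q≡1+m)) (NP.m+n∸m≡n (2 + t) q)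

      lower-label : ∀ {x} → ¬ Upper x → L₀ x ≤ suc t
      lower-label {x} ¬up with inTrunk? c x | x F.≟ z′
      ... | yes x∈trunk | _        = NP.m≤n⇒m≤1+n (trunk-label≤t x∈trunk)
      ... | no _        | yes refl = NP.≤-reflexive z′-label
      ... | no x∉trunk  | no x≢z′  = contradiction (x∉trunk , x≢z′) ¬up

    rankB-total : rankB (suc m) ≡ k
    rankB-total = begin
      rankB (suc m)                                                     ≡⟨ cong rankB 2+t+q≡1+m ⟨
      rankB (2 + t + q)                                                 ≡⟨ sumBelow-+ (2 + t) q _ ⟩
      rankB (2 + t) + sumBelow q (occupied L₀)                          ≡⟨ cong₂ _+_ no-low-branch-labels (occupancy packed₀) ⟩
      k                                                                 ∎
      where
        open ≡-Reasoning
        no-low-branch-labels : rankB (2 + t) ≡ 0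
        no-low-branch-labels = sumBelow-zero (2 + t) _ λ w w<2+t →
          indicator-no (λ (b , b∈B , L₀b≡w) → NP.<⇒≱ w<2+t (subst (2 + t ≤_) L₀b≡w (upper-label (branch⇒Upper b∈B)))) _

    #other≤q : #other ≤ q
    #other≤q = subst (#other ≤_) 1+m∸[2+t]≡q (Count.count-absent-below otherLabel? (2 + t)
      (λ w w<2+t (x , (x∈Q , _) , L₀x≡w) → NP.<⇒≱ w<2+t (subst (2 + t ≤_) L₀x≡w (upper-label x∈Q))) (suc m))

    q≤k+#other : q ≤ k + #other
    q≤k+#other = subst₂ _≤_ 1+m∸[2+t]≡q (cong (_+ #other) rankB-total)
      (count-cover (branchLabel? L₀) otherLabel? (2 + t) (suc m) upper-labels-split (suc m) NP.≤-refl)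
      where
        upper-labels-split : ∀ w → 2 + t ≤ w → w < suc m → BranchLabel L₀ w ⊎ OtherLabel w
        upper-labels-split w 2+t≤w w≤m with L₀-onto w (NP.≤-trans (s≤s z≤n) 2+t≤w) (NP.≤-pred w≤m)
        ... | x , L₀x≡w with upper? x | x ∈? B
        ...   | no ¬up | _       = contradiction (subst (_≤ suc t) L₀x≡w (lower-label ¬up)) (NP.<⇒≱ 2+t≤w)
        ...   | yes _  | yes x∈B = inj₁ (x , x∈B , L₀x≡w)
        ...   | yes up | no x∉B  = inj₂ (x , (up , x∉B) , L₀x≡w)

    base+#other≡1+m : base + #other ≡ suc m
    base+#other≡1+m = NP.m∸n+n≡m (NP.≤-trans #other≤q (NP.≤-trans (NP.m≤n+m q (2 + t)) (NP.≤-reflexive 2+t+q≡1+m)))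

    2+t≤base : 2 + t ≤ base
    2+t≤base = NP.+-cancelʳ-≤ #other (2 + t) base
      (subst (2 + t + #other ≤_) (sym base+#other≡1+m) (NP.≤-trans (NP.+-monoʳ-≤ (2 + t) #other≤q) (NP.≤-reflexive 2+t+q≡1+m)))

    base≤2+t+k : base ≤ 2 + t + k
    base≤2+t+k = NP.+-cancelʳ-≤ #other base (2 + t + k)
      (subst (_≤ 2 + t + k + #other) (sym base+#other≡1+m)
        (subst (_≤ 2 + t + k + #other) 2+t+q≡1+m (subst (2 + t + q ≤_) (sym (NP.+-assoc (2 + t) k #other)) (NP.+-monoʳ-≤ (2 + t) q≤k+#other))))

    L₁ : Fin n → ℕ
    L₁ x with upper? x | x ∈? B
    ... | no _  | _     = L₀ x
    ... | yes _ | yes _ = 2 + t + rankB (L₀ x)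
    ... | yes _ | no _  = base + rankO (L₀ x)

    L₁-lower : ∀ {x} → ¬ Upper x → L₁ x ≡ L₀ x
    L₁-lower {x} ¬up with upper? x
    ... | yes up = contradiction up ¬up
    ... | no _   = refl

    L₁-branch : ∀ {x} → x ∈ B → L₁ x ≡ 2 + t + rankB (L₀ x)
    L₁-branch {x} x∈B with upper? x | x ∈? B
    ... | no ¬up | _      = contradiction (branch⇒Upper x∈B) ¬up
    ... | yes _  | yes _  = refl
    ... | yes _  | no x∉B = contradiction x∈B x∉B

    L₁-other : ∀ {x} → Other x → L₁ x ≡ base + rankO (L₀ x)
    L₁-other {x} (up , x∉B) with upper? x | x ∈? B
    ... | no ¬up | _      = contradiction up ¬up
    ... | yes _  | yes x∈B = contradiction x∈B x∉B
    ... | yes _  | no _   = refl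

    data Region (x : Fin n) : Set where
      lower  : ¬ Upper x → Region x
      inB    : x ∈ B → Region x
      beside : Other x → Region x

    region : ∀ x → Region x
    region x with upper? x | x ∈? B
    ... | no ¬up | _       = lower ¬up
    ... | yes _  | yes x∈B = inB x∈B
    ... | yes up | no x∉B  = beside (up , x∉B)

    private
      L₀<1+m : ∀ x → L₀ x < suc m
      L₀<1+m x = s≤s (proj₂ (L₀-range x))

      rankB<k : ∀ {b} → b ∈ B → rankB (L₀ b) < k
      rankB<k {b} b∈B = subst (rankB (L₀ b) <_) rankB-total (Count.count-increases (branchLabel? L₀) (b , b∈B , refl) (L₀<1+m b))

      rankO<#other : ∀ {x} → Other x → rankO (L₀ x) < #other
      rankO<#other {x} other = Count.count-increases otherLabel? (x , other , refl) (L₀<1+m x)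

      upper-L₁ : ∀ {x} → Upper x → 2 + t ≤ L₁ x
      upper-L₁ {x} up with region x
      ... | lower ¬up    = contradiction up ¬up
      ... | inB x∈B      = subst (2 + t ≤_) (sym (L₁-branch x∈B)) (NP.m≤m+n (2 + t) _)
      ... | beside other = subst (2 + t ≤_) (sym (L₁-other other)) (NP.≤-trans 2+t≤base (NP.m≤m+n base _))

      lower<upper : ∀ {x y} → ¬ Upper x → Upper y → L₁ x < L₁ y
      lower<upper ¬upx upy = NP.<-≤-trans (s≤s (subst (_≤ suc t) (sym (L₁-lower ¬upx)) (lower-label ¬upx))) (upper-L₁ upy)

    L₁-range : ∀ x → 1 ≤ L₁ x × L₁ x ≤ m
    L₁-range x with region x
    ... | lower ¬up = subst (λ v → 1 ≤ v × v ≤ m) (sym (L₁-lower ¬up)) (L₀-range x)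
    ... | inB x∈B   = subst (λ v → 1 ≤ v × v ≤ m) (sym (L₁-branch x∈B))
                        (s≤s z≤n , NP.<⇒≤ (NP.<-≤-trans (NP.+-monoʳ-< (2 + t) (rankB<k x∈B)) 2+t+k≤m))
    ... | beside other = subst (λ v → 1 ≤ v × v ≤ m) (sym (L₁-other other))
                           (NP.≤-trans (s≤s z≤n) (NP.≤-trans 2+t≤base (NP.m≤m+n base _)) ,
                            NP.≤-pred (subst (base + rankO (L₀ x) <_) base+#other≡1+m (NP.+-monoʳ-< base (rankO<#other other))))

    L₁-mono : StrictlyMonotone L₁
    L₁-mono x y x≺y with region x | region y
    ... | lower ¬upx | lower ¬upy = subst₂ _<_ (sym (L₁-lower ¬upx)) (sym (L₁-lower ¬upy)) (L₀-mono x y x≺y)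
    ... | lower ¬upx | inB y∈B    = lower<upper ¬upx (branch⇒Upper y∈B)
    ... | lower ¬upx | beside (upy , _) = lower<upper ¬upx upy
    ... | inB x∈B    | lower ¬upy = contradiction (z′≺⇒Upper (≺-trans (Upper⇒z′≺ (branch⇒Upper x∈B)) x≺y)) ¬upy
    ... | beside (upx , _) | lower ¬upy = contradiction (z′≺⇒Upper (≺-trans (Upper⇒z′≺ upx) x≺y)) ¬upy
    ... | inB x∈B    | inB y∈B    = subst₂ _<_ (sym (L₁-branch x∈B)) (sym (L₁-branch y∈B))
                                      (NP.+-monoʳ-< (2 + t) (Count.count-increases (branchLabel? L₀) (x , x∈B , refl) (L₀-mono x y x≺y)))
    ... | inB x∈B    | beside (_ , y∉B) = contradiction (branch-upward-closed x∈B x≺y) y∉B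
    ... | beside (upx , x∉B) | inB y∈B = contradiction (branch-downward-closed y∈B upx x≺y) x∉B
    ... | beside otherx | beside othery = subst₂ _<_ (sym (L₁-other otherx)) (sym (L₁-other othery))
                                      (NP.+-monoʳ-< base (Count.count-increases otherLabel? (x , otherx , refl) (L₀-mono x y x≺y)))

    branch-offset-hit : ∀ {o} → o < k → BranchLabel L₁ (2 + t + o)
    branch-offset-hit {o} o<k with Count.count-hit (branchLabel? L₀) (suc m) o (subst (o <_) (sym rankB-total) o<k)
    ... | w , _ , (b , b∈B , L₀b≡w) , rankB-w≡o = b , b∈B , trans (L₁-branch b∈B) (trans (cong (λ v → 2 + t + rankB v) L₀b≡w) (cong (2 + t +_) rankB-w≡o))

    branch-offset-bound : ∀ {o} → BranchLabel L₁ (2 + t + o) → o < k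
    branch-offset-bound (b , b∈B , L₁b≡2+t+o) = subst (_< k) (NP.+-cancelˡ-≡ (2 + t) _ _ (trans (sym (L₁-branch b∈B)) L₁b≡2+t+o)) (rankB<k b∈B)

    private
      other-hit : ∀ {v} → base ≤ v → v ≤ m → ∃ λ x → L₁ x ≡ v
      other-hit {v} base≤v v≤m with Count.count-hit otherLabel? (suc m) (v ∸ base)
        (m<o+n⇒m∸n<o v base #other base≤v (subst (v <_) (trans (sym base+#other≡1+m) (NP.+-comm base #other)) (s≤s v≤m)))
      ... | w , _ , (x , other , L₀x≡w) , rankO-w≡v∸base =
        x , trans (L₁-other other) (trans (cong (λ u → base + rankO u) L₀x≡w) (trans (cong (base +_) rankO-w≡v∸base) (NP.m+[n∸m]≡n base≤v)))

    L₁-onto : ∀ v → 1 ≤ v → v ≤ m → ∃ λ x → L₁ x ≡ v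
    L₁-onto v 1≤v v≤m with v NP.<? 2 + t | v NP.<? 2 + t + k
    ... | yes v<2+t | _ = let (x , L₀x≡v) = L₀-onto v 1≤v v≤m
                              ¬up = λ up → NP.<⇒≱ v<2+t (subst (2 + t ≤_) L₀x≡v (upper-label up)) in
                          x , trans (L₁-lower ¬up) L₀x≡v
    ... | no v≮2+t | yes v<2+t+k =
      let 2+t≤v = NP.≮⇒≥ v≮2+t
          (b , b∈B , L₁b≡) = branch-offset-hit (m<o+n⇒m∸n<o v (2 + t) k 2+t≤v (subst (v <_) (NP.+-comm (2 + t) k) v<2+t+k)) in
      b , trans L₁b≡ (NP.m+[n∸m]≡n 2+t≤v)
    ... | no _ | no v≮2+t+k = other-hit (NP.≤-trans base≤2+t+k (NP.≮⇒≥ v≮2+t+k)) v≤m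

    L₁-packed : IsPackedLabeling P m L₁
    L₁-packed = L₁-range , L₁-onto , L₁-mono

  order-divisible : ∀ d → IsOrderOfPromotion P m d → m ∸ t ∸ 1 ∣ d
  order-divisible d (_ , periodic , _) = subst (_∣ d) (sym q≡) (rotation-fixing-prefix⇒∣ 1≤k k<q stable)
    where
      open Squeezed using (L₁; L₁-packed; branch-offset-hit; branch-offset-bound)
      stable : ∀ o → o < q → (o + d) % q < k → o < k
      stable o o<q shifted<k = branch-offset-bound (indicator≡1 (branchLabel? L₁ (2 + t + o)) (begin
        occupied L₁ o               ≡⟨ occupied-cong (sym ∘ periodic L₁ L₁-packed) o ⟩
        occupied (iter d ∂ L₁) o    ≡⟨ occupied-iterate L₁-packed d o o<q ⟩
        occupied L₁ ((o + d) % q)   ≡⟨ indicator-yes (branch-offset-hit shifted<k) _ ⟩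
        1                           ∎))
        where open ≡-Reasoning

corollary2p5 :
    ∀ {n : ℕ} (P : FinPoset n) (z : Fin n) → IsMinimum P z →
    ∀ (t : ℕ) (c : Fin t → Fin n) → IsTrunk P z t c →
    ∀ (m : ℕ) → 1 ≤ m → (∃ λ L → IsPackedLabeling P m L) →
    ∀ (z' : Fin n) → IsMinimumOfComplement P c z' →
    ∀ (k : ℕ) (B : Subset n) → IsBranch P c z' B → ∣ B ∣ ≡ k →
    1 ≤ k → k + t + 2 ≤ m →
    (∀ d → IsOrderOfPromotion P m d → (m ∸ t ∸ 1) ∣ d)
    × (gcd k (m ∸ t ∸ 1) ≡ 1 →
       ∀ L → IsPackedLabeling P m L → ∀ d → IsOrbitSize P m L d → (m ∸ t ∸ 1) ∣ d)
corollary2p5 P z z-min t c trunk m 1≤m (L₀ , packed₀) z′ z′-min k B branch ∣B∣≡k 1≤k k+t+2≤m =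
  order-divisible , λ gcd≡1 L packed d (_ , periodic , _) → orbit-divisible gcd≡1 packed d periodic
  where open Corollary P z z-min c (proj₁ trunk) z′ z′-min B branch 1≤m ∣B∣≡k 1≤k k+t+2≤m packed₀
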